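{- Let $\Delta,\Gamma$ be visibility functions and $P,Q$ closed processes. If $P\approx^{\Delta}_{\Gamma,\mathrm{tr}}Q$, then $\nu a\,P\approx^{\Delta\setminus a}_{\Gamma\setminus a,\mathrm{tr}}\nu a\,Q$.
   Context: Calculus. Names are partitioned into higher-order names $a,b,c,\dots$ (set $N_{ho}$), first-order names $h,k$, success names $\omega$; first-order values $v$, variables $x$, expressions $e,f$ (closed ones evaluate: $e\Downarrow v$). Processes: $P::= a(x,b).P \mid h(x).P \mid \overline{a}\langle e\rangle(b).P \mid \overline{h}\langle e\rangle.P \mid \omega.P \mid\ !\alpha.P \mid P|Q \mid \nu a\,P \mid \nu h\,P \mid 0 \mid P+Q \mid \mathtt{if}\ e=f\ \mathtt{then}\ P\ \mathtt{else}\ Q$ ($\alpha$ an input prefix; $\overline a\langle e\rangle(b)$ outputs $e$ with a fresh bound name $b$; closed processes up to $\alpha$-conversion). Actions $\mu::=\tau\mid a\langle v\rangle(b)\mid \overline a\langle v\rangle(b)\mid h\langle v\rangle\mid \overline h\langle v\rangle\mid\omega$ with the standard transitions: $a(x,b).P\xrightarrow{a\langle v\rangle(b)}P[v/x]$; $\overline a\langle e\rangle(b).P\xrightarrow{\overline a\langle v\rangle(b)}P$ if $e\Downarrow v$; $h(x).P\xrightarrow{h\langle v\rangle}P[v/x]$; $\overline h\langle e\rangle.P\xrightarrow{\overline h\langle v\rangle}P$ if $e\Downarrow v$; $\omega.P\xrightarrow{\omega}0$; replication $!\alpha.P$ behaves as $\alpha.P|!\alpha.P$; restriction $\nu n$ lets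 through actions not mentioning $n$; sum chooses a summand; $P|Q\xrightarrow{\tau}\nu b(P'|Q')$ if $P\xrightarrow{a\langle v\rangle(b)}P'$, $Q\xrightarrow{\overline a\langle v\rangle(b)}Q'$; $P|Q\xrightarrow{\tau}P'|Q'$ if $P\xrightarrow{h\langle v\rangle}P'$, $Q\xrightarrow{\overline h\langle v\rangle}Q'$; interleaving of a component's action when its bound names are not free in the other; conditional follows the branch selected by the values of $e,f$. A visibility function is a finite partial transitive function $\Delta:N_{ho}\cup\{\mathsf{cur}\}\to\mathcal P_{fin}(N_{ho})$ (transitive: $o,a\in\mathrm{dom}\Delta$, $a\in\Delta(o)$ imply $\Delta(a)\subseteq\Delta(o)$). $\Delta,p\mapsto V$ extends; $\Delta\setminus p$ erases $p$ from domain and all values; $(\Delta_1,\Delta_2)\in\mathrm{split}(\Delta)$ iff $\Delta_1\cup\Delta_2=\Delta$ (domain union, pointwise union) and $\mathsf{cur}\notin\mathrm{dom}\Delta_1\cap\mathrm{dom}\Delta_2$; $\Delta,\Gamma$ compatible iff $\mathsf{cur}\notin\mathrm{dom}\Delta\cap\mathrm{dom}\Gamma$. Typing $\Delta\vdash P$: least relation with $\Delta\vdash\overline a\langle e\rangle(b).P$ if $a\in\Delta(\mathsf{cur})$ and $(\Delta\setminus\mathsf{cur}),b\mapsto\Delta(\mathsf{cur})\cup\{b\}\vdash P$; $\Delta\vdash a(x,b).P$ if $\mathsf{cur}\notin\mathrm{dom}\Delta$, $a\in\mathrm{dom}\Delta$, $\Delta,\mathsf{cur}\mapsto\Delta(a)\cup\{b\}\vdash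 P$; $\Delta\vdash\overline h\langle e\rangle.P$ if $\Delta\vdash P$, $\mathsf{cur}\notin\mathrm{dom}\Delta$; $\Delta\vdash h(x).P$ if $\Delta\vdash P$, $\mathsf{cur}\in\mathrm{dom}\Delta$; $\Delta\vdash!\alpha.P$ if $\Delta\vdash\alpha.P$, $\mathsf{cur}\notin\mathrm{dom}\Delta$; $\Delta\vdash\omega.P$; $\Delta\setminus a\vdash\nu aP$ if $\Delta\vdash P$; $\Delta\vdash\nu hP$ if $\Delta\vdash P$; $\Delta\vdash0$ if $\mathsf{cur}\notin\mathrm{dom}\Delta$; sums/conditionals if both branches typed under $\Delta$; $\Delta\vdash P_1|P_2$ if $\Delta_i\vdash P_i$, $(\Delta_1,\Delta_2)\in\mathrm{split}(\Delta)$. Type-allowed transitions (observer visibility $\Gamma$): if $P\xrightarrow{\overline a\langle v\rangle(b)}P'$, $a\in\mathrm{dom}\Gamma$, $\mathsf{cur}\notin\mathrm{dom}\Gamma$: $\Gamma:P\xrightarrow{\overline a\langle v\rangle(b)}(\Gamma,\mathsf{cur}\mapsto\Gamma(a)\cup\{b\}):P'$; if $P\xrightarrow{a\langle v\rangle(b)}P'$, $a\in\Gamma(\mathsf{cur})$: $\Gamma:P\xrightarrow{a\langle v\rangle(b)}((\Gamma\setminus\mathsf{cur}),b\mapsto\Gamma(\mathsf{cur})\cup\{b\}):P'$; $\overline h\langle v\rangle$ allowed (observer unchanged) if $\mathsf{cur}\in\mathrm{dom}\Gamma$; $h\langle v\rangle$ and $\tau$ allowed (unchanged) if $\mathsf{cur}\notin\mathrm{dom}\Gamma$.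 $\Gamma:P\xRightarrow{\mu}\Gamma':P'$ iff typed $\tau$-steps, then a $\mu$-step, then typed $\tau$-steps. A trace is a finite sequence $\mu_1\dots\mu_n$ of non-$\tau$ actions with pairwise distinct bound names, distinct from its free names; it is a trace of $P_0$ under $\Gamma_0$ if $\Gamma_{i-1}:P_{i-1}\xRightarrow{\mu_i}\Gamma_i:P_i$ for some $P_i,\Gamma_i$, $1\le i\le n$. For $P,Q$ with $\Delta\vdash P,Q$: $P\approx^{\Delta}_{\Gamma,\mathrm{tr}}Q$ iff $\Delta,\Gamma$ compatible and $P,Q$ have the same traces under $\Gamma$. -}

module Defs where

open import Data.Nat using (ℕ; _+_; _≟_; _≡ᵇ_)
open import Data.Bool using (Bool; true; false; if_then_else_)
open import Data.List using (List; []; _∷_; _++_; _∷ʳ_; filter; mapMaybe)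
open import Data.List.Membership.Propositional using (_∈_; _∉_)
open import Data.List.Relation.Unary.All using (All)
open import Data.List.Relation.Unary.Unique.Propositional using (Unique)
open import Data.Maybe using (Maybe; just; nothing)
import Data.Maybe as M
open import Data.Product using (Σ; ∃; ∃₂; _×_; _,_)
open import Data.Sum using (_⊎_)
open import Data.Unit using (⊤)
open import Relation.Nullary using (¬_; yes; no; ¬?)
open import Relation.Binary.Definitions using (DecidableEquality)
open import Relation.Binary.PropositionalEquality using (_≡_; _≢_; refl)

Name  : Set
Name  = ℕ
FName : Set
FName = ℕ
SName : Set
SName = ℕ
Var   : Set
Var   = ℕ
Val   : Set
Val   = ℕ

data Expr : Set where
  lit  : Val → Expr
  var  : Var → Expr
  plus : Expr → Expr → Expr

data _⇓_ : Expr → Val → Set where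
  ⇓lit  : ∀ {v} → lit v ⇓ v
  ⇓plus : ∀ {e f m n} → e ⇓ m → f ⇓ n → plus e f ⇓ (m + n)

-- Processes (raw terms; identified up to α-conversion via _≡α_ below)

data Proc : Set where
  inHO  : Name → Var → Name → Proc → Proc    -- a(x,b).P      (binds x, b)
  inFO  : FName → Var → Proc → Proc          -- h(x).P        (binds x)
  outHO : Name → Expr → Name → Proc → Proc   -- ā⟨e⟩(b).P     (binds b)
  outFO : FName → Expr → Proc → Proc
  succ  : SName → Proc → Proc
  repHO : Name → Var → Name → Proc → Proc
  repFO : FName → Var → Proc → Proc
  _∣_   : Proc → Proc → Proc
  νH    : Name → Proc → Proc
  νF    : FName → Proc → Proc
  nil   : Proc
  _⊕_   : Proc → Proc → Proc
  ite   : Expr → Expr → Proc → Proc → Proc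

data EWS (xs : List Var) : Expr → Set where
  wlit  : ∀ {v} → EWS xs (lit v)
  wvar  : ∀ {x} → x ∈ xs → EWS xs (var x)
  wplus : ∀ {e f} → EWS xs e → EWS xs f → EWS xs (plus e f)

data WS (xs : List Var) : Proc → Set where
  wInHO  : ∀ {a x b P} → WS (x ∷ xs) P → WS xs (inHO a x b P)
  wInFO  : ∀ {h x P} → WS (x ∷ xs) P → WS xs (inFO h x P)
  wOutHO : ∀ {a e b P} → EWS xs e → WS xs P → WS xs (outHO a e b P)
  wOutFO : ∀ {h e P} → EWS xs e → WS xs P → WS xs (outFO h e P)
  wSucc  : ∀ {ω P} → WS xs P → WS xs (succ ω P)
  wRepHO : ∀ {a x b P} → WS (x ∷ xs) P → WS xs (repHO a x b P)
  wRepFO : ∀ {h x P} → WS (x ∷ xs) P → WS xs (repFO h x P)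
  wPar   : ∀ {P Q} → WS xs P → WS xs Q → WS xs (P ∣ Q)
  wνH    : ∀ {a P} → WS xs P → WS xs (νH a P)
  wνF    : ∀ {h P} → WS xs P → WS xs (νF h P)
  wNil   : WS xs nil
  wSum   : ∀ {P Q} → WS xs P → WS xs Q → WS xs (P ⊕ Q)
  wIte   : ∀ {e f P Q} → EWS xs e → EWS xs f → WS xs P → WS xs Q →
           WS xs (ite e f P Q)

Closed : Proc → Set
Closed = WS []

esub : Expr → Var → Val → Expr
esub (lit w)    x v = lit w
esub (var y)    x v = if y ≡ᵇ x then lit v else var y
esub (plus e f) x v = plus (esub e x v) (esub f x v)

psub : Proc → Var → Val → Proc
psub (inHO a y b P)  x v = inHO a y b (if y ≡ᵇ x then P else psub P x v)
psub (inFO h y P)    x v = inFO h y (if y ≡ᵇ x then P else psub P x v)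
psub (outHO a e b P) x v = outHO a (esub e x v) b (psub P x v)
psub (outFO h e P)   x v = outFO h (esub e x v) (psub P x v)
psub (succ ω P)      x v = succ ω (psub P x v)
psub (repHO a y b P) x v = repHO a y b (if y ≡ᵇ x then P else psub P x v)
psub (repFO h y P)   x v = repFO h y (if y ≡ᵇ x then P else psub P x v)
psub (P ∣ Q)         x v = psub P x v ∣ psub Q x v
psub (νH a P)        x v = νH a (psub P x v)
psub (νF h P)        x v = νF h (psub P x v)
psub nil             x v = nil
psub (P ⊕ Q)         x v = psub P x v ⊕ psub Q x v
psub (ite e f P Q)   x v = ite (esub e x v) (esub f x v) (psub P x v) (psub Q x v)

removeN : Name → List Name → List Name
removeN b = filter (λ n → ¬? (n ≟ b))

hnames : Proc → List Name
hnames (inHO a x b P)  = a ∷ b ∷ hnames P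
hnames (inFO h x P)    = hnames P
hnames (outHO a e b P) = a ∷ b ∷ hnames P
hnames (outFO h e P)   = hnames P
hnames (succ ω P)      = hnames P
hnames (repHO a x b P) = a ∷ b ∷ hnames P
hnames (repFO h x P)   = hnames P
hnames (P ∣ Q)         = hnames P ++ hnames Q
hnames (νH a P)        = a ∷ hnames P
hnames (νF h P)        = hnames P
hnames nil             = []
hnames (P ⊕ Q)         = hnames P ++ hnames Q
hnames (ite e f P Q)   = hnames P ++ hnames Q

fhn : Proc → List Name
fhn (inHO a x b P)  = a ∷ removeN b (fhn P)
fhn (inFO h x P)    = fhn P
fhn (outHO a e b P) = a ∷ removeN b (fhn P)
fhn (outFO h e P)   = fhn P
fhn (succ ω P)      = fhn P
fhn (repHO a x b P) = a ∷ removeN b (fhn P)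
fhn (repFO h x P)   = fhn P
fhn (P ∣ Q)         = fhn P ++ fhn Q
fhn (νH a P)        = removeN a (fhn P)
fhn (νF h P)        = fhn P
fhn nil             = []
fhn (P ⊕ Q)         = fhn P ++ fhn Q
fhn (ite e f P Q)   = fhn P ++ fhn Q

fnames : Proc → List FName
fnames (inHO a x b P)  = fnames P
fnames (inFO h x P)    = h ∷ fnames P
fnames (outHO a e b P) = fnames P
fnames (outFO h e P)   = h ∷ fnames P
fnames (succ ω P)      = fnames P
fnames (repHO a x b P) = fnames P
fnames (repFO h x P)   = h ∷ fnames P
fnames (P ∣ Q)         = fnames P ++ fnames Q
fnames (νH a P)        = fnames P
fnames (νF h P)        = h ∷ fnames P
fnames nil             = []
fnames (P ⊕ Q)         = fnames P ++ fnames Q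
fnames (ite e f P Q)   = fnames P ++ fnames Q

-- renaming of free occurrences of the higher-order name b to c:  P[c/b]
-- (only used with c not occurring in P, where it is capture-free)
hren : Name → Name → Proc → Proc
hren c b (inHO a x b' P)  = inHO (if a ≡ᵇ b then c else a) x b'
                              (if b' ≡ᵇ b then P else hren c b P)
hren c b (inFO h x P)     = inFO h x (hren c b P)
hren c b (outHO a e b' P) = outHO (if a ≡ᵇ b then c else a) e b'
                              (if b' ≡ᵇ b then P else hren c b P)
hren c b (outFO h e P)    = outFO h e (hren c b P)
hren c b (succ ω P)       = succ ω (hren c b P)
hren c b (repHO a x b' P) = repHO (if a ≡ᵇ b then c else a) x b'
                              (if b' ≡ᵇ b then P else hren c b P)
hren c b (repFO h x P)    = repFO h x (hren c b P)
hren c b (P ∣ Q)          = hren c b P ∣ hren c b Q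
hren c b (νH a P)         = νH a (if a ≡ᵇ b then P else hren c b P)
hren c b (νF h P)         = νF h (hren c b P)
hren c b nil              = nil
hren c b (P ⊕ Q)          = hren c b P ⊕ hren c b Q
hren c b (ite e f P Q)    = ite e f (hren c b P) (hren c b Q)

fren : FName → FName → Proc → Proc
fren k h (inHO a x b P)  = inHO a x b (fren k h P)
fren k h (inFO h' x P)   = inFO (if h' ≡ᵇ h then k else h') x (fren k h P)
fren k h (outHO a e b P) = outHO a e b (fren k h P)
fren k h (outFO h' e P)  = outFO (if h' ≡ᵇ h then k else h') e (fren k h P)
fren k h (succ ω P)      = succ ω (fren k h P)
fren k h (repHO a x b P) = repHO a x b (fren k h P)
fren k h (repFO h' x P)  = repFO (if h' ≡ᵇ h then k else h') x (fren k h P)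
fren k h (P ∣ Q)         = fren k h P ∣ fren k h Q
fren k h (νH a P)        = νH a (fren k h P)
fren k h (νF h' P)       = νF h' (if h' ≡ᵇ h then P else fren k h P)
fren k h nil             = nil
fren k h (P ⊕ Q)         = fren k h P ⊕ fren k h Q
fren k h (ite e f P Q)   = ite e f (fren k h P) (fren k h Q)

-- α-conversion (of bound names): the least congruence and equivalence
-- containing the renaming of a bound name into a completely fresh one.

infix 4 _≡α_
data _≡α_ : Proc → Proc → Set where
  α-refl  : ∀ {P} → P ≡α P
  α-sym   : ∀ {P Q} → P ≡α Q → Q ≡α P
  α-trans : ∀ {P Q R} → P ≡α Q → Q ≡α R → P ≡α R
  α-inHO  : ∀ {a x b c P} → c ∉ hnames P → inHO a x b P ≡α inHO a x c (hren c b P)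
  α-outHO : ∀ {a e b c P} → c ∉ hnames P → outHO a e b P ≡α outHO a e c (hren c b P)
  α-repHO : ∀ {a x b c P} → c ∉ hnames P → repHO a x b P ≡α repHO a x c (hren c b P)
  α-νH    : ∀ {b c P} → c ∉ hnames P → νH b P ≡α νH c (hren c b P)
  α-νF    : ∀ {h k P} → k ∉ fnames P → νF h P ≡α νF k (fren k h P)
  c-inHO  : ∀ {a x b P P'} → P ≡α P' → inHO a x b P ≡α inHO a x b P'
  c-inFO  : ∀ {h x P P'} → P ≡α P' → inFO h x P ≡α inFO h x P'
  c-outHO : ∀ {a e b P P'} → P ≡α P' → outHO a e b P ≡α outHO a e b P'
  c-outFO : ∀ {h e P P'} → P ≡α P' → outFO h e P ≡α outFO h e P'
  c-succ  : ∀ {ω P P'} → P ≡α P' → succ ω P ≡α succ ω P'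
  c-repHO : ∀ {a x b P P'} → P ≡α P' → repHO a x b P ≡α repHO a x b P'
  c-repFO : ∀ {h x P P'} → P ≡α P' → repFO h x P ≡α repFO h x P'
  c-par   : ∀ {P P' Q Q'} → P ≡α P' → Q ≡α Q' → (P ∣ Q) ≡α (P' ∣ Q')
  c-νH    : ∀ {a P P'} → P ≡α P' → νH a P ≡α νH a P'
  c-νF    : ∀ {h P P'} → P ≡α P' → νF h P ≡α νF h P'
  c-sum   : ∀ {P P' Q Q'} → P ≡α P' → Q ≡α Q' → (P ⊕ Q) ≡α (P' ⊕ Q')
  c-ite   : ∀ {e f P P' Q Q'} → P ≡α P' → Q ≡α Q' → ite e f P Q ≡α ite e f P' Q'

data Act : Set where
  τ    : Act
  inA  : Name → Val → Name → Act
  outA : Name → Val → Name → Act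
  inF  : FName → Val → Act
  outF : FName → Val → Act
  ok   : SName → Act

bn : Act → Maybe Name
bn (inA a v b)  = just b
bn (outA a v b) = just b
bn _            = nothing

chan : Act → Maybe Name
chan (inA a v b)  = just a
chan (outA a v b) = just a
chan _            = nothing

actH : Act → List Name
actH (inA a v b)  = a ∷ b ∷ []
actH (outA a v b) = a ∷ b ∷ []
actH _            = []

actF : Act → List FName
actF (inF h v)  = h ∷ []
actF (outF h v) = h ∷ []
actF _          = []

BnFresh : Act → Proc → Set
BnFresh μ Q = ∀ b → bn μ ≡ just b → b ∉ fhn Q

infix 3 _—[_]→_
data _—[_]→_ : Proc → Act → Proc → Set where
  t-inHO  : ∀ {a x b P v} → inHO a x b P —[ inA a v b ]→ psub P x v
  t-outHO : ∀ {a e b P v} → e ⇓ v → outHO a e b P —[ outA a v b ]→ P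
  t-inFO  : ∀ {h x P v} → inFO h x P —[ inF h v ]→ psub P x v
  t-outFO : ∀ {h e P v} → e ⇓ v → outFO h e P —[ outF h v ]→ P
  t-succ  : ∀ {ω P} → succ ω P —[ ok ω ]→ nil
  t-repHO : ∀ {a x b P μ R} → (inHO a x b P ∣ repHO a x b P) —[ μ ]→ R →
            repHO a x b P —[ μ ]→ R
  t-repFO : ∀ {h x P μ R} → (inFO h x P ∣ repFO h x P) —[ μ ]→ R →
            repFO h x P —[ μ ]→ R
  t-νH    : ∀ {n P P' μ} → P —[ μ ]→ P' → n ∉ actH μ → νH n P —[ μ ]→ νH n P'
  t-νF    : ∀ {h P P' μ} → P —[ μ ]→ P' → h ∉ actF μ → νF h P —[ μ ]→ νF h P'
  t-sumL  : ∀ {P Q P' μ} → P —[ μ ]→ P' → (P ⊕ Q) —[ μ ]→ P'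
  t-sumR  : ∀ {P Q Q' μ} → Q —[ μ ]→ Q' → (P ⊕ Q) —[ μ ]→ Q'
  t-then  : ∀ {e f P Q P' μ v} → e ⇓ v → f ⇓ v → P —[ μ ]→ P' →
            ite e f P Q —[ μ ]→ P'
  t-else  : ∀ {e f P Q Q' μ v w} → e ⇓ v → f ⇓ w → v ≢ w → Q —[ μ ]→ Q' →
            ite e f P Q —[ μ ]→ Q'
  t-commHO-l : ∀ {P Q P' Q' a v b} → P —[ inA a v b ]→ P' → Q —[ outA a v b ]→ Q' →
               (P ∣ Q) —[ τ ]→ νH b (P' ∣ Q')
  t-commHO-r : ∀ {P Q P' Q' a v b} → P —[ outA a v b ]→ P' → Q —[ inA a v b ]→ Q' →
               (P ∣ Q) —[ τ ]→ νH b (P' ∣ Q')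
  t-commFO-l : ∀ {P Q P' Q' h v} → P —[ inF h v ]→ P' → Q —[ outF h v ]→ Q' →
               (P ∣ Q) —[ τ ]→ (P' ∣ Q')
  t-commFO-r : ∀ {P Q P' Q' h v} → P —[ outF h v ]→ P' → Q —[ inF h v ]→ Q' →
               (P ∣ Q) —[ τ ]→ (P' ∣ Q')
  t-parL  : ∀ {P Q P' μ} → P —[ μ ]→ P' → BnFresh μ Q → (P ∣ Q) —[ μ ]→ (P' ∣ Q)
  t-parR  : ∀ {P Q Q' μ} → Q —[ μ ]→ Q' → BnFresh μ P → (P ∣ Q) —[ μ ]→ (P ∣ Q')
  -- processes are taken up to α-conversion
  t-α     : ∀ {P P' P'' μ} → P ≡α P' → P' —[ μ ]→ P'' → P —[ μ ]→ P''

-- Visibility functions  Δ : N_ho ∪ {cur} ⇀ P_fin(N_ho)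
-- represented as maps Key → Maybe (List Name) (lists read as finite sets)

data Key : Set where
  cur : Key
  hn  : Name → Key

_≟K_ : DecidableEquality Key
cur  ≟K cur  = yes refl
cur  ≟K hn _ = no λ ()
hn _ ≟K cur  = no λ ()
hn m ≟K hn n with m ≟ n
... | yes refl = yes refl
... | no m≢n   = no λ { refl → m≢n refl }

VF : Set
VF = Key → Maybe (List Name)

_∈dom_ : Key → VF → Set
k ∈dom Δ = ∃ λ V → Δ k ≡ just V

_∈at_ : Name → VF × Key → Set
n ∈at (Δ , k) = ∃ λ V → Δ k ≡ just V × n ∈ V

get : VF → Key → List Name
get Δ k = M.fromMaybe [] (Δ k)

upd : VF → Key → List Name → VF
upd Δ k V k' with k' ≟K k
... | yes _ = just V
... | no _  = Δ k'

infixl 6 _∖_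
_∖_ : VF → Key → VF
(Δ ∖ k) k' with k' ≟K k
... | yes _ = nothing
... | no _  = M.map (filter (λ n → ¬? (hn n ≟K k))) (Δ k')

IsVis : VF → Set
IsVis Δ = (∃ λ (L : List Key) → ∀ k → k ∈dom Δ → k ∈ L)
        × (∀ o a → a ∈at (Δ , o) → hn a ∈dom Δ →
             ∀ n → n ∈at (Δ , hn a) → n ∈at (Δ , o))

_≈V_ : VF → VF → Set
Δ ≈V Δ' = ∀ k → ((k ∈dom Δ → k ∈dom Δ') × (k ∈dom Δ' → k ∈dom Δ))
              × (∀ n → (n ∈at (Δ , k) → n ∈at (Δ' , k)) × (n ∈at (Δ' , k) → n ∈at (Δ , k)))

Split : VF → VF → VF → Set
Split Δ Δ₁ Δ₂ =
    IsVis Δ₁ × IsVis Δ₂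
  × (∀ k → (k ∈dom Δ → k ∈dom Δ₁ ⊎ k ∈dom Δ₂) × (k ∈dom Δ₁ ⊎ k ∈dom Δ₂ → k ∈dom Δ))
  × (∀ k n → (n ∈at (Δ , k) → n ∈at (Δ₁ , k) ⊎ n ∈at (Δ₂ , k))
           × (n ∈at (Δ₁ , k) ⊎ n ∈at (Δ₂ , k) → n ∈at (Δ , k)))
  × ¬ (cur ∈dom Δ₁ × cur ∈dom Δ₂)

Compatible : VF → VF → Set
Compatible Δ Γ = ¬ (cur ∈dom Δ × cur ∈dom Γ)

-- Typing  Δ ⊢ P  (on raw terms; every judgement is on a visibility function)

infix 3 _⊢_
data _⊢_ : VF → Proc → Set where
  ty-outHO : ∀ {Δ a e b P} → IsVis Δ → a ∈at (Δ , cur) →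
             ¬ (hn b ∈dom (Δ ∖ cur)) →
             upd (Δ ∖ cur) (hn b) (get Δ cur ∷ʳ b) ⊢ P →
             Δ ⊢ outHO a e b P
  ty-inHO  : ∀ {Δ a x b P} → IsVis Δ → ¬ (cur ∈dom Δ) → hn a ∈dom Δ →
             upd Δ cur (get Δ (hn a) ∷ʳ b) ⊢ P →
             Δ ⊢ inHO a x b P
  ty-outFO : ∀ {Δ h e P} → IsVis Δ → Δ ⊢ P → ¬ (cur ∈dom Δ) → Δ ⊢ outFO h e P
  ty-inFO  : ∀ {Δ h x P} → IsVis Δ → Δ ⊢ P → cur ∈dom Δ → Δ ⊢ inFO h x P
  ty-repHO : ∀ {Δ a x b P} → IsVis Δ → Δ ⊢ inHO a x b P → ¬ (cur ∈dom Δ) →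
             Δ ⊢ repHO a x b P
  ty-repFO : ∀ {Δ h x P} → IsVis Δ → Δ ⊢ inFO h x P → ¬ (cur ∈dom Δ) →
             Δ ⊢ repFO h x P
  ty-succ  : ∀ {Δ ω P} → IsVis Δ → Δ ⊢ succ ω P
  ty-νH    : ∀ {Δ Δ' a P} → IsVis Δ' → Δ' ≈V (Δ ∖ hn a) → Δ ⊢ P → Δ' ⊢ νH a P
  ty-νF    : ∀ {Δ h P} → IsVis Δ → Δ ⊢ P → Δ ⊢ νF h P
  ty-nil   : ∀ {Δ} → IsVis Δ → ¬ (cur ∈dom Δ) → Δ ⊢ nil
  ty-sum   : ∀ {Δ P Q} → IsVis Δ → Δ ⊢ P → Δ ⊢ Q → Δ ⊢ (P ⊕ Q)
  ty-ite   : ∀ {Δ e f P Q} → IsVis Δ → Δ ⊢ P → Δ ⊢ Q → Δ ⊢ ite e f P Q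
  ty-par   : ∀ {Δ Δ₁ Δ₂ P Q} → IsVis Δ → Split Δ Δ₁ Δ₂ → Δ₁ ⊢ P → Δ₂ ⊢ Q →
             Δ ⊢ (P ∣ Q)

Typed : VF → Proc → Set
Typed Δ P = ∃ λ P' → P ≡α P' × Δ ⊢ P'

data Allowed : VF → Proc → Act → VF → Proc → Set where
  al-outHO : ∀ {Γ P P' a v b} → P —[ outA a v b ]→ P' → hn a ∈dom Γ → ¬ (cur ∈dom Γ) →
             Allowed Γ P (outA a v b) (upd Γ cur (get Γ (hn a) ∷ʳ b)) P'
  al-inHO  : ∀ {Γ P P' a v b} → P —[ inA a v b ]→ P' → a ∈at (Γ , cur) →
             ¬ (hn b ∈dom (Γ ∖ cur)) →
             Allowed Γ P (inA a v b) (upd (Γ ∖ cur) (hn b) (get Γ cur ∷ʳ b)) P'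
  al-outFO : ∀ {Γ P P' h v} → P —[ outF h v ]→ P' → cur ∈dom Γ →
             Allowed Γ P (outF h v) Γ P'
  al-inFO  : ∀ {Γ P P' h v} → P —[ inF h v ]→ P' → ¬ (cur ∈dom Γ) →
             Allowed Γ P (inF h v) Γ P'
  al-τ     : ∀ {Γ P P'} → P —[ τ ]→ P' → ¬ (cur ∈dom Γ) →
             Allowed Γ P τ Γ P'

data TauStar (Γ : VF) : Proc → Proc → Set where
  τ-refl : ∀ {P} → TauStar Γ P P
  τ-step : ∀ {P P' P''} → Allowed Γ P τ Γ P' → TauStar Γ P' P'' → TauStar Γ P P''

Weak : VF → Proc → Act → VF → Proc → Set
Weak Γ P μ Γ' P' = ∃₂ λ P₁ P₂ → TauStar Γ P P₁ × Allowed Γ P₁ μ Γ' P₂ × TauStar Γ' P₂ P'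

bns : List Act → List Name
bns = mapMaybe bn

chans : List Act → List Name
chans = mapMaybe chan

-- a trace: finite sequence of non-τ actions, with pairwise distinct bound
-- names, distinct from its free names (a bound name of the i-th action is
-- not used as a channel at any position ≤ i, where it would be free)
IsTrace : List Act → Set
IsTrace t = All (λ μ → μ ≢ τ) t
          × Unique (bns t)
          × (∀ xs μ ys b → t ≡ xs ++ μ ∷ ys → bn μ ≡ just b → b ∉ chans (xs ∷ʳ μ))

TraceOf : VF → Proc → List Act → Set
TraceOf Γ P []      = ⊤
TraceOf Γ P (μ ∷ t) = ∃₂ λ Γ' P' → Weak Γ P μ Γ' P' × TraceOf Γ' P' t

TraceEq : VF → VF → Proc → Proc → Set
TraceEq Δ Γ P Q = Typed Δ P × Typed Δ Q × Compatible Δ Γ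
                × (∀ t → IsTrace t → (TraceOf Γ P t → TraceOf Γ Q t) × (TraceOf Γ Q t → TraceOf Γ P t))

-- A trace of ν a P observed through Γ ∖ a may still mention a, as a bound
-- name.  Transposing a with a name z fresh for everything in sight fixes
-- Γ ∖ a and, up to α-conversion, ν a P; since traces are equivariant, ν a P
-- performs the trace iff it performs its transposed copy, which avoids a.
-- For traces avoiding a, ν a P under Γ ∖ a and P under Γ simulate each
-- other step by step: the restriction only blocks actions that mention a,
-- and erasing a from the observer commutes with every observer update caused
-- by an action avoiding a.

module Submission where

open import Defs
open import Data.Bool using (true; false; if_then_else_; T)
open import Data.Empty using (⊥-elim)
open import Data.List using (List; []; _∷_; _++_; _∷ʳ_; filter; map; [_])
open import Data.List.Extrema.Nat using (max; xs≤max)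
open import Data.List.Membership.Propositional using (_∈_; _∉_)
open import Data.List.Membership.Propositional.Properties
  using (∈-map⁺; ∈-map⁻; ∈-++⁺ˡ; ∈-++⁺ʳ; ∈-++⁻; ∈-filter⁺; ∈-filter⁻)
open import Data.List.Properties using (map-++; map-id; map-id-local; ++-assoc)
open import Data.List.Relation.Binary.Subset.Propositional using (_⊆_)
open import Data.List.Relation.Binary.Subset.Propositional.Properties using (∷⁺ʳ; ++⁺)
open import Data.List.Relation.Unary.All as All using (All; []; _∷_)
open import Data.List.Relation.Unary.All.Properties using (map⁺)
open import Data.List.Relation.Unary.Any using (here; there)
open import Data.List.Relation.Unary.Unique.Propositional using (Unique)
import Data.List.Relation.Unary.Unique.Propositional.Properties as Unique
open import Data.Maybe using (Maybe; just; nothing)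
import Data.Maybe as M
import Data.Maybe.Properties as M
open import Data.Nat using (ℕ; zero; suc; _≟_; _≡ᵇ_)
open import Data.Nat.Properties using (≡ᵇ⇒≡; <-irrefl)
open import Data.Product using (∃; ∃₂; _×_; _,_; proj₁; proj₂)
open import Data.Sum using (_⊎_; inj₁; inj₂; [_,_]′) renaming (map₁ to ⊎-map₁)
open import Data.Unit using (⊤; tt)
open import Function using (_∘_; id)
open import Function.Definitions using (Injective)
open import Relation.Nullary using (yes; no; ¬?)
open import Relation.Binary.PropositionalEquality
  using (_≡_; _≢_; refl; sym; trans; cong; cong₂; subst; subst₂; module ≡-Reasoning)

≡ᵇ-refl : ∀ n → (n ≡ᵇ n) ≡ true
≡ᵇ-refl zero    = refl
≡ᵇ-refl (suc n) = ≡ᵇ-refl n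

≡ᵇ-true⇒≡ : ∀ {m n} → (m ≡ᵇ n) ≡ true → m ≡ n
≡ᵇ-true⇒≡ {m} {n} eq = ≡ᵇ⇒≡ m n (subst T (sym eq) tt)

≡ᵇ-false⇒≢ : ∀ {m n} → (m ≡ᵇ n) ≡ false → m ≢ n
≡ᵇ-false⇒≢ {m} eq refl = subst T eq (subst T (sym (≡ᵇ-refl m)) tt)

≢⇒≡ᵇ-false : ∀ {m n} → m ≢ n → (m ≡ᵇ n) ≡ false
≢⇒≡ᵇ-false {m} {n} m≢n with m ≡ᵇ n in eq
... | false = refl
... | true  = ⊥-elim (m≢n (≡ᵇ-true⇒≡ eq))

≡ᵇ-injective : ∀ {f : ℕ → ℕ} → Injective _≡_ _≡_ f → ∀ m n → (f m ≡ᵇ f n) ≡ (m ≡ᵇ n)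
≡ᵇ-injective {f} inj m n with m ≟ n
... | yes refl = trans (≡ᵇ-refl (f m)) (sym (≡ᵇ-refl m))
... | no m≢n   = trans (≢⇒≡ᵇ-false (m≢n ∘ inj)) (sym (≢⇒≡ᵇ-false m≢n))

∉∷⇒≢ : ∀ {z a : ℕ} {xs} → z ∉ a ∷ xs → a ≢ z
∉∷⇒≢ z∉ a≡z = z∉ (here (sym a≡z))

∉∷⇒∉ : ∀ {z a : ℕ} {xs} → z ∉ a ∷ xs → z ∉ xs
∉∷⇒∉ z∉ = z∉ ∘ there

∉++⇒∉ˡ : ∀ {z : ℕ} xs {ys} → z ∉ xs ++ ys → z ∉ xs
∉++⇒∉ˡ xs z∉ = z∉ ∘ ∈-++⁺ˡ

∉++⇒∉ʳ : ∀ {z : ℕ} xs {ys} → z ∉ xs ++ ys → z ∉ ys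
∉++⇒∉ʳ xs z∉ = z∉ ∘ ∈-++⁺ʳ xs

-- Abstract: otherwise with-abstraction over a fresh name normalises the proof term.
abstract
  fresh : (xs : List ℕ) → ∃ λ z → z ∉ xs
  fresh xs = suc (max 0 xs) , λ z∈ → <-irrefl refl (All.lookup (xs≤max 0 xs) z∈)

transpose : ℕ → ℕ → ℕ → ℕ
transpose x y n with n ≟ x
... | yes _ = y
... | no _ with n ≟ y
...   | yes _ = x
...   | no _  = n

transpose-ˡ : ∀ x y → transpose x y x ≡ y
transpose-ˡ x y with x ≟ x
... | yes _   = refl
... | no x≢x  = ⊥-elim (x≢x refl)

transpose-ʳ : ∀ x y → transpose x y y ≡ x
transpose-ʳ x y with y ≟ x
... | yes refl = refl
... | no _ with y ≟ y
...   | yes _  = refl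
...   | no y≢y = ⊥-elim (y≢y refl)

transpose-other : ∀ x y n → n ≢ x → n ≢ y → transpose x y n ≡ n
transpose-other x y n n≢x n≢y with n ≟ x
... | yes n≡x = ⊥-elim (n≢x n≡x)
... | no _ with n ≟ y
...   | yes n≡y = ⊥-elim (n≢y n≡y)
...   | no _    = refl

data TransposeView (x y n : ℕ) : Set where
  at-x      : n ≡ x → TransposeView x y n
  at-y      : n ≢ x → n ≡ y → TransposeView x y n
  elsewhere : n ≢ x → n ≢ y → TransposeView x y n

transpose-view : ∀ x y n → TransposeView x y n
transpose-view x y n with n ≟ x
... | yes n≡x = at-x n≡x
... | no n≢x with n ≟ y
...   | yes n≡y = at-y n≢x n≡y
...   | no n≢y  = elsewhere n≢x n≢y

transpose-involutive : ∀ x y n → transpose x y (transpose x y n) ≡ n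
transpose-involutive x y n with transpose-view x y n
... | at-x refl   = trans (cong (transpose x y) (transpose-ˡ x y)) (transpose-ʳ x y)
... | at-y _ refl = trans (cong (transpose x y) (transpose-ʳ x y)) (transpose-ˡ x y)
... | elsewhere n≢x n≢y =
  trans (cong (transpose x y) (transpose-other x y n n≢x n≢y)) (transpose-other x y n n≢x n≢y)

transpose-injective : ∀ x y → Injective _≡_ _≡_ (transpose x y)
transpose-injective x y {m} {n} eq =
  trans (sym (transpose-involutive x y m)) (trans (cong (transpose x y) eq) (transpose-involutive x y n))

transpose-comm : ∀ x y n → transpose x y n ≡ transpose y x n
transpose-comm x y n with transpose-view x y n
... | at-x refl   = trans (transpose-ˡ x y) (sym (transpose-ʳ y x))
... | at-y _ refl = trans (transpose-ʳ x y) (sym (transpose-ˡ y x))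
... | elsewhere n≢x n≢y = trans (transpose-other x y n n≢x n≢y) (sym (transpose-other y x n n≢y n≢x))

transpose-same : ∀ x n → transpose x x n ≡ n
transpose-same x n with transpose-view x x n
... | at-x refl   = transpose-ˡ x x
... | at-y _ refl = transpose-ʳ x x
... | elsewhere n≢x _ = transpose-other x x n n≢x n≢x

transpose-fix-∉ : ∀ z d {n} {xs : List ℕ} → z ∉ xs → d ∉ xs → n ∈ xs → transpose z d n ≡ n
transpose-fix-∉ z d z∉ d∉ n∈ =
  transpose-other z d _ (λ e → z∉ (subst (_∈ _) e n∈)) (λ e → d∉ (subst (_∈ _) e n∈))

transpose-∘-transpose : ∀ z w d n → n ≢ z → n ≢ w →
                        transpose z w (transpose w d n) ≡ transpose z d n
transpose-∘-transpose z w d n n≢z n≢w with n ≟ d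
... | yes refl rewrite transpose-ʳ w n | transpose-ʳ z w | transpose-ʳ z n = refl
... | no n≢d
  rewrite transpose-other w d n n≢w n≢d | transpose-other z w n n≢z n≢w
        | transpose-other z d n n≢z n≢d = refl

transpose-triangle : ∀ x y w → x ≢ y → w ≢ x → w ≢ y → ∀ n →
                     transpose w y (transpose x y n) ≡ transpose w x (transpose y w n)
transpose-triangle x y w x≢y w≢x w≢y n with transpose-view x y n
... | at-x refl
  rewrite transpose-ˡ x y | transpose-other y w x x≢y (w≢x ∘ sym)
        | transpose-ʳ w y | transpose-ʳ w x = refl
... | at-y _ refl
  rewrite transpose-ʳ x y | transpose-other w y x (w≢x ∘ sym) x≢y
        | transpose-ˡ y w | transpose-ˡ w x = refl
... | elsewhere n≢x n≢y with n ≟ w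
...   | yes refl
  rewrite transpose-other x y w w≢x w≢y | transpose-ˡ w y | transpose-ʳ y w
        | transpose-other w x y (w≢y ∘ sym) (x≢y ∘ sym) = refl
...   | no n≢w
  rewrite transpose-other x y n n≢x n≢y | transpose-other w y n n≢w n≢y
        | transpose-other y w n n≢y n≢w | transpose-other w x n n≢w n≢x = refl

rename : (ℕ → ℕ) → Proc → Proc
rename f (inHO a x b P)  = inHO (f a) x (f b) (rename f P)
rename f (inFO h x P)    = inFO h x (rename f P)
rename f (outHO a e b P) = outHO (f a) e (f b) (rename f P)
rename f (outFO h e P)   = outFO h e (rename f P)
rename f (succ w P)      = succ w (rename f P)
rename f (repHO a x b P) = repHO (f a) x (f b) (rename f P)
rename f (repFO h x P)   = repFO h x (rename f P)
rename f (P ∣ Q)         = rename f P ∣ rename f Q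
rename f (νH a P)        = νH (f a) (rename f P)
rename f (νF h P)        = νF h (rename f P)
rename f nil             = nil
rename f (P ⊕ Q)         = rename f P ⊕ rename f Q
rename f (ite e g P Q)   = ite e g (rename f P) (rename f Q)

renameAct : (ℕ → ℕ) → Act → Act
renameAct f τ            = τ
renameAct f (inA a v b)  = inA (f a) v (f b)
renameAct f (outA a v b) = outA (f a) v (f b)
renameAct f (inF h v)    = inF h v
renameAct f (outF h v)   = outF h v
renameAct f (ok w)       = ok w

rename-agree : ∀ {f g} P → (∀ {n} → n ∈ hnames P → f n ≡ g n) → rename f P ≡ rename g P
rename-agree (inHO a x b P) agree rewrite agree (here refl) | agree (there (here refl)) =
  cong (inHO _ x _) (rename-agree P (agree ∘ there ∘ there))
rename-agree (outHO a e b P) agree rewrite agree (here refl) | agree (there (here refl)) =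
  cong (outHO _ e _) (rename-agree P (agree ∘ there ∘ there))
rename-agree (repHO a x b P) agree rewrite agree (here refl) | agree (there (here refl)) =
  cong (repHO _ x _) (rename-agree P (agree ∘ there ∘ there))
rename-agree (νH a P) agree = cong₂ νH (agree (here refl)) (rename-agree P (agree ∘ there))
rename-agree (inFO h x P) agree = cong (inFO h x) (rename-agree P agree)
rename-agree (outFO h e P) agree = cong (outFO h e) (rename-agree P agree)
rename-agree (succ w P) agree = cong (succ w) (rename-agree P agree)
rename-agree (repFO h x P) agree = cong (repFO h x) (rename-agree P agree)
rename-agree (νF h P) agree = cong (νF h) (rename-agree P agree)
rename-agree nil agree = refl
rename-agree (P ∣ Q) agree =
  cong₂ _∣_ (rename-agree P (agree ∘ ∈-++⁺ˡ)) (rename-agree Q (agree ∘ ∈-++⁺ʳ (hnames P)))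
rename-agree (P ⊕ Q) agree =
  cong₂ _⊕_ (rename-agree P (agree ∘ ∈-++⁺ˡ)) (rename-agree Q (agree ∘ ∈-++⁺ʳ (hnames P)))
rename-agree (ite e g P Q) agree =
  cong₂ (ite e g) (rename-agree P (agree ∘ ∈-++⁺ˡ)) (rename-agree Q (agree ∘ ∈-++⁺ʳ (hnames P)))

rename-ext : ∀ {f g} → (∀ n → f n ≡ g n) → ∀ P → rename f P ≡ rename g P
rename-ext f≗g P = rename-agree P (λ _ → f≗g _)

rename-∘ : ∀ f g P → rename f (rename g P) ≡ rename (f ∘ g) P
rename-∘ f g (inHO a x b P) = cong (inHO _ x _) (rename-∘ f g P)
rename-∘ f g (inFO h x P) = cong (inFO h x) (rename-∘ f g P)
rename-∘ f g (outHO a e b P) = cong (outHO _ e _) (rename-∘ f g P)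
rename-∘ f g (outFO h e P) = cong (outFO h e) (rename-∘ f g P)
rename-∘ f g (succ w P) = cong (succ w) (rename-∘ f g P)
rename-∘ f g (repHO a x b P) = cong (repHO _ x _) (rename-∘ f g P)
rename-∘ f g (repFO h x P) = cong (repFO h x) (rename-∘ f g P)
rename-∘ f g (P ∣ Q) = cong₂ _∣_ (rename-∘ f g P) (rename-∘ f g Q)
rename-∘ f g (νH a P) = cong (νH _) (rename-∘ f g P)
rename-∘ f g (νF h P) = cong (νF h) (rename-∘ f g P)
rename-∘ f g nil = refl
rename-∘ f g (P ⊕ Q) = cong₂ _⊕_ (rename-∘ f g P) (rename-∘ f g Q)
rename-∘ f g (ite e h P Q) = cong₂ (ite e h) (rename-∘ f g P) (rename-∘ f g Q)

rename-id : ∀ P → rename id P ≡ P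
rename-id (inHO a x b P) = cong (inHO a x b) (rename-id P)
rename-id (inFO h x P) = cong (inFO h x) (rename-id P)
rename-id (outHO a e b P) = cong (outHO a e b) (rename-id P)
rename-id (outFO h e P) = cong (outFO h e) (rename-id P)
rename-id (succ w P) = cong (succ w) (rename-id P)
rename-id (repHO a x b P) = cong (repHO a x b) (rename-id P)
rename-id (repFO h x P) = cong (repFO h x) (rename-id P)
rename-id (P ∣ Q) = cong₂ _∣_ (rename-id P) (rename-id Q)
rename-id (νH a P) = cong (νH a) (rename-id P)
rename-id (νF h P) = cong (νF h) (rename-id P)
rename-id nil = refl
rename-id (P ⊕ Q) = cong₂ _⊕_ (rename-id P) (rename-id Q)
rename-id (ite e h P Q) = cong₂ (ite e h) (rename-id P) (rename-id Q)

hnames-rename : ∀ f P → hnames (rename f P) ≡ map f (hnames P)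
hnames-rename f (inHO a x b P) = cong (λ l → f a ∷ f b ∷ l) (hnames-rename f P)
hnames-rename f (outHO a e b P) = cong (λ l → f a ∷ f b ∷ l) (hnames-rename f P)
hnames-rename f (repHO a x b P) = cong (λ l → f a ∷ f b ∷ l) (hnames-rename f P)
hnames-rename f (νH a P) = cong (f a ∷_) (hnames-rename f P)
hnames-rename f (inFO h x P) = hnames-rename f P
hnames-rename f (outFO h e P) = hnames-rename f P
hnames-rename f (succ w P) = hnames-rename f P
hnames-rename f (repFO h x P) = hnames-rename f P
hnames-rename f (νF h P) = hnames-rename f P
hnames-rename f nil = refl
hnames-rename f (P ∣ Q) =
  trans (cong₂ _++_ (hnames-rename f P) (hnames-rename f Q)) (sym (map-++ f (hnames P) (hnames Q)))
hnames-rename f (P ⊕ Q) =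
  trans (cong₂ _++_ (hnames-rename f P) (hnames-rename f Q)) (sym (map-++ f (hnames P) (hnames Q)))
hnames-rename f (ite e g P Q) =
  trans (cong₂ _++_ (hnames-rename f P) (hnames-rename f Q)) (sym (map-++ f (hnames P) (hnames Q)))

fnames-rename : ∀ f P → fnames (rename f P) ≡ fnames P
fnames-rename f (inHO a x b P) = fnames-rename f P
fnames-rename f (inFO h x P) = cong (h ∷_) (fnames-rename f P)
fnames-rename f (outHO a e b P) = fnames-rename f P
fnames-rename f (outFO h e P) = cong (h ∷_) (fnames-rename f P)
fnames-rename f (succ w P) = fnames-rename f P
fnames-rename f (repHO a x b P) = fnames-rename f P
fnames-rename f (repFO h x P) = cong (h ∷_) (fnames-rename f P)
fnames-rename f (P ∣ Q) = cong₂ _++_ (fnames-rename f P) (fnames-rename f Q)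
fnames-rename f (νH a P) = fnames-rename f P
fnames-rename f (νF h P) = cong (h ∷_) (fnames-rename f P)
fnames-rename f nil = refl
fnames-rename f (P ⊕ Q) = cong₂ _++_ (fnames-rename f P) (fnames-rename f Q)
fnames-rename f (ite e g P Q) = cong₂ _++_ (fnames-rename f P) (fnames-rename f Q)

rename-psub : ∀ f P x v → rename f (psub P x v) ≡ psub (rename f P) x v
rename-psub f (inHO a y b P) x v with y ≡ᵇ x
... | true  = refl
... | false = cong (inHO _ y _) (rename-psub f P x v)
rename-psub f (inFO h y P) x v with y ≡ᵇ x
... | true  = refl
... | false = cong (inFO h y) (rename-psub f P x v)
rename-psub f (repHO a y b P) x v with y ≡ᵇ x
... | true  = refl
... | false = cong (repHO _ y _) (rename-psub f P x v)
rename-psub f (repFO h y P) x v with y ≡ᵇ x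
... | true  = refl
... | false = cong (repFO h y) (rename-psub f P x v)
rename-psub f (outHO a e b P) x v = cong (outHO _ _ _) (rename-psub f P x v)
rename-psub f (outFO h e P) x v = cong (outFO h _) (rename-psub f P x v)
rename-psub f (succ w P) x v = cong (succ w) (rename-psub f P x v)
rename-psub f (νH a P) x v = cong (νH _) (rename-psub f P x v)
rename-psub f (νF h P) x v = cong (νF h) (rename-psub f P x v)
rename-psub f nil x v = refl
rename-psub f (P ∣ Q) x v = cong₂ _∣_ (rename-psub f P x v) (rename-psub f Q x v)
rename-psub f (P ⊕ Q) x v = cong₂ _⊕_ (rename-psub f P x v) (rename-psub f Q x v)
rename-psub f (ite e g P Q) x v = cong₂ (ite _ _) (rename-psub f P x v) (rename-psub f Q x v)

rename-fren : ∀ f k h P → rename f (fren k h P) ≡ fren k h (rename f P)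
rename-fren f k h (inHO a x b P) = cong (inHO _ x _) (rename-fren f k h P)
rename-fren f k h (inFO h' x P) = cong (inFO _ x) (rename-fren f k h P)
rename-fren f k h (outHO a e b P) = cong (outHO _ e _) (rename-fren f k h P)
rename-fren f k h (outFO h' e P) = cong (outFO _ e) (rename-fren f k h P)
rename-fren f k h (succ w P) = cong (succ w) (rename-fren f k h P)
rename-fren f k h (repHO a x b P) = cong (repHO _ x _) (rename-fren f k h P)
rename-fren f k h (repFO h' x P) = cong (repFO _ x) (rename-fren f k h P)
rename-fren f k h (P ∣ Q) = cong₂ _∣_ (rename-fren f k h P) (rename-fren f k h Q)
rename-fren f k h (νH a P) = cong (νH _) (rename-fren f k h P)
rename-fren f k h (νF h' P) with h' ≡ᵇ h
... | true  = refl
... | false = cong (νF h') (rename-fren f k h P)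
rename-fren f k h nil = refl
rename-fren f k h (P ⊕ Q) = cong₂ _⊕_ (rename-fren f k h P) (rename-fren f k h Q)
rename-fren f k h (ite e g P Q) = cong₂ (ite e g) (rename-fren f k h P) (rename-fren f k h Q)

∉fnames-rename : ∀ f {k} P → k ∉ fnames P → k ∉ fnames (rename f P)
∉fnames-rename f P = subst (_ ∉_) (sym (fnames-rename f P))

actH-renameAct : ∀ f μ → actH (renameAct f μ) ≡ map f (actH μ)
actH-renameAct f τ = refl
actH-renameAct f (inA a v b) = refl
actH-renameAct f (outA a v b) = refl
actH-renameAct f (inF h v) = refl
actH-renameAct f (outF h v) = refl
actH-renameAct f (ok w) = refl

actF-renameAct : ∀ f μ → actF (renameAct f μ) ≡ actF μ
actF-renameAct f τ = refl
actF-renameAct f (inA a v b) = refl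
actF-renameAct f (outA a v b) = refl
actF-renameAct f (inF h v) = refl
actF-renameAct f (outF h v) = refl
actF-renameAct f (ok w) = refl

bn-renameAct⁻ : ∀ f μ {b} → bn (renameAct f μ) ≡ just b → ∃ λ b₀ → bn μ ≡ just b₀ × b ≡ f b₀
bn-renameAct⁻ f (inA a v b) refl = b , refl , refl
bn-renameAct⁻ f (outA a v b) refl = b , refl , refl

-- Injectivity is needed because rename also renames bound names.
module _ {f : ℕ → ℕ} (f-injective : Injective _≡_ _≡_ f) where

  ∉-map⁺ : ∀ {n xs} → n ∉ xs → f n ∉ map f xs
  ∉-map⁺ n∉ fn∈ with ∈-map⁻ f fn∈
  ... | m , m∈ , fn≡fm = n∉ (subst (_∈ _) (f-injective (sym fn≡fm)) m∈)

  ∉hnames-rename : ∀ {c} P → c ∉ hnames P → f c ∉ hnames (rename f P)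
  ∉hnames-rename P c∉ = subst (f _ ∉_) (sym (hnames-rename f P)) (∉-map⁺ c∉)

  rename-hren : ∀ c b P → rename f (hren c b P) ≡ hren (f c) (f b) (rename f P)
  rename-hren c b (inHO a x b' P)
    rewrite ≡ᵇ-injective f-injective a b | ≡ᵇ-injective f-injective b' b with a ≡ᵇ b | b' ≡ᵇ b
  ... | true  | true  = refl
  ... | true  | false = cong (inHO _ x _) (rename-hren c b P)
  ... | false | true  = refl
  ... | false | false = cong (inHO _ x _) (rename-hren c b P)
  rename-hren c b (outHO a e b' P)
    rewrite ≡ᵇ-injective f-injective a b | ≡ᵇ-injective f-injective b' b with a ≡ᵇ b | b' ≡ᵇ b
  ... | true  | true  = refl
  ... | true  | false = cong (outHO _ e _) (rename-hren c b P)
  ... | false | true  = refl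
  ... | false | false = cong (outHO _ e _) (rename-hren c b P)
  rename-hren c b (repHO a x b' P)
    rewrite ≡ᵇ-injective f-injective a b | ≡ᵇ-injective f-injective b' b with a ≡ᵇ b | b' ≡ᵇ b
  ... | true  | true  = refl
  ... | true  | false = cong (repHO _ x _) (rename-hren c b P)
  ... | false | true  = refl
  ... | false | false = cong (repHO _ x _) (rename-hren c b P)
  rename-hren c b (νH a P) rewrite ≡ᵇ-injective f-injective a b with a ≡ᵇ b
  ... | true  = refl
  ... | false = cong (νH _) (rename-hren c b P)
  rename-hren c b (inFO h x P) = cong (inFO h x) (rename-hren c b P)
  rename-hren c b (outFO h e P) = cong (outFO h e) (rename-hren c b P)
  rename-hren c b (succ w P) = cong (succ w) (rename-hren c b P)
  rename-hren c b (repFO h x P) = cong (repFO h x) (rename-hren c b P)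
  rename-hren c b (νF h P) = cong (νF h) (rename-hren c b P)
  rename-hren c b nil = refl
  rename-hren c b (P ∣ Q) = cong₂ _∣_ (rename-hren c b P) (rename-hren c b Q)
  rename-hren c b (P ⊕ Q) = cong₂ _⊕_ (rename-hren c b P) (rename-hren c b Q)
  rename-hren c b (ite e g P Q) = cong₂ (ite e g) (rename-hren c b P) (rename-hren c b Q)

  removeN-map : ∀ b xs → removeN (f b) (map f xs) ≡ map f (removeN b xs)
  removeN-map b [] = refl
  removeN-map b (x ∷ xs) rewrite ≡ᵇ-injective f-injective x b with x ≡ᵇ b
  ... | true  = removeN-map b xs
  ... | false = cong (f x ∷_) (removeN-map b xs)

  fhn-rename-binder : ∀ b P → removeN (f b) (fhn (rename f P)) ≡ map f (removeN b (fhn P))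

  fhn-rename : ∀ P → fhn (rename f P) ≡ map f (fhn P)
  fhn-rename (inHO a x b P) = cong (f a ∷_) (fhn-rename-binder b P)
  fhn-rename (outHO a e b P) = cong (f a ∷_) (fhn-rename-binder b P)
  fhn-rename (repHO a x b P) = cong (f a ∷_) (fhn-rename-binder b P)
  fhn-rename (νH a P) = fhn-rename-binder a P
  fhn-rename (inFO h x P) = fhn-rename P
  fhn-rename (outFO h e P) = fhn-rename P
  fhn-rename (succ w P) = fhn-rename P
  fhn-rename (repFO h x P) = fhn-rename P
  fhn-rename (νF h P) = fhn-rename P
  fhn-rename nil = refl
  fhn-rename (P ∣ Q) = trans (cong₂ _++_ (fhn-rename P) (fhn-rename Q)) (sym (map-++ f (fhn P) (fhn Q)))
  fhn-rename (P ⊕ Q) = trans (cong₂ _++_ (fhn-rename P) (fhn-rename Q)) (sym (map-++ f (fhn P) (fhn Q)))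
  fhn-rename (ite e g P Q) = trans (cong₂ _++_ (fhn-rename P) (fhn-rename Q)) (sym (map-++ f (fhn P) (fhn Q)))

  fhn-rename-binder b P = trans (cong (removeN (f b)) (fhn-rename P)) (removeN-map b (fhn P))

  rename-≡α : ∀ {P Q} → P ≡α Q → rename f P ≡α rename f Q
  rename-≡α α-refl = α-refl
  rename-≡α (α-sym p) = α-sym (rename-≡α p)
  rename-≡α (α-trans p q) = α-trans (rename-≡α p) (rename-≡α q)
  rename-≡α (α-inHO {c = c} {P = P} c∉) =
    subst (λ R → inHO _ _ _ (rename f P) ≡α inHO _ _ (f c) R) (sym (rename-hren c _ P))
          (α-inHO (∉hnames-rename P c∉))
  rename-≡α (α-outHO {c = c} {P = P} c∉) =
    subst (λ R → outHO _ _ _ (rename f P) ≡α outHO _ _ (f c) R) (sym (rename-hren c _ P))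
          (α-outHO (∉hnames-rename P c∉))
  rename-≡α (α-repHO {c = c} {P = P} c∉) =
    subst (λ R → repHO _ _ _ (rename f P) ≡α repHO _ _ (f c) R) (sym (rename-hren c _ P))
          (α-repHO (∉hnames-rename P c∉))
  rename-≡α (α-νH {c = c} {P = P} c∉) =
    subst (λ R → νH _ (rename f P) ≡α νH (f c) R) (sym (rename-hren c _ P)) (α-νH (∉hnames-rename P c∉))
  rename-≡α (α-νF {h = h} {k = k} {P = P} k∉) =
    subst (λ R → νF h (rename f P) ≡α νF k R) (sym (rename-fren f k h P)) (α-νF (∉fnames-rename f P k∉))
  rename-≡α (c-inHO p) = c-inHO (rename-≡α p)
  rename-≡α (c-inFO p) = c-inFO (rename-≡α p)
  rename-≡α (c-outHO p) = c-outHO (rename-≡α p)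
  rename-≡α (c-outFO p) = c-outFO (rename-≡α p)
  rename-≡α (c-succ p) = c-succ (rename-≡α p)
  rename-≡α (c-repHO p) = c-repHO (rename-≡α p)
  rename-≡α (c-repFO p) = c-repFO (rename-≡α p)
  rename-≡α (c-par p q) = c-par (rename-≡α p) (rename-≡α q)
  rename-≡α (c-νH p) = c-νH (rename-≡α p)
  rename-≡α (c-νF p) = c-νF (rename-≡α p)
  rename-≡α (c-sum p q) = c-sum (rename-≡α p) (rename-≡α q)
  rename-≡α (c-ite p q) = c-ite (rename-≡α p) (rename-≡α q)

  rename-BnFresh : ∀ μ Q → BnFresh μ Q → BnFresh (renameAct f μ) (rename f Q)
  rename-BnFresh μ Q fresh b bn≡ with bn-renameAct⁻ f μ bn≡
  ... | b₀ , bn₀≡ , refl = subst (f b₀ ∉_) (sym (fhn-rename Q)) (∉-map⁺ (fresh b₀ bn₀≡))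

  rename-step : ∀ {P μ P'} → P —[ μ ]→ P' → rename f P —[ renameAct f μ ]→ rename f P'
  rename-step (t-inHO {x = x} {P = P} {v = v}) = subst (_ —[ _ ]→_) (sym (rename-psub f P x v)) t-inHO
  rename-step (t-inFO {x = x} {P = P} {v = v}) = subst (_ —[ _ ]→_) (sym (rename-psub f P x v)) t-inFO
  rename-step (t-outHO e⇓) = t-outHO e⇓
  rename-step (t-outFO e⇓) = t-outFO e⇓
  rename-step t-succ = t-succ
  rename-step (t-repHO s) = t-repHO (rename-step s)
  rename-step (t-repFO s) = t-repFO (rename-step s)
  rename-step (t-νH {μ = μ} s n∉) = t-νH (rename-step s) (subst (_ ∉_) (sym (actH-renameAct f μ)) (∉-map⁺ n∉))
  rename-step (t-νF {μ = μ} s h∉) = t-νF (rename-step s) (subst (_ ∉_) (sym (actF-renameAct f μ)) h∉)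
  rename-step (t-sumL s) = t-sumL (rename-step s)
  rename-step (t-sumR s) = t-sumR (rename-step s)
  rename-step (t-then e⇓ f⇓ s) = t-then e⇓ f⇓ (rename-step s)
  rename-step (t-else e⇓ f⇓ v≢w s) = t-else e⇓ f⇓ v≢w (rename-step s)
  rename-step (t-commHO-l s₁ s₂) = t-commHO-l (rename-step s₁) (rename-step s₂)
  rename-step (t-commHO-r s₁ s₂) = t-commHO-r (rename-step s₁) (rename-step s₂)
  rename-step (t-commFO-l s₁ s₂) = t-commFO-l (rename-step s₁) (rename-step s₂)
  rename-step (t-commFO-r s₁ s₂) = t-commFO-r (rename-step s₁) (rename-step s₂)
  rename-step (t-parL {Q = Q} {μ = μ} s fresh) = t-parL (rename-step s) (rename-BnFresh μ Q fresh)
  rename-step (t-parR {P = P} {μ = μ} s fresh) = t-parR (rename-step s) (rename-BnFresh μ P fresh)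
  rename-step (t-α p s) = t-α (rename-≡α p) (rename-step s)

∈-removeN⁻ : ∀ {n b} xs → n ∈ removeN b xs → n ∈ xs × n ≢ b
∈-removeN⁻ {b = b} xs p = ∈-filter⁻ (λ m → ¬? (m ≟ b)) p

∈-removeN⁺ : ∀ {n b xs} → n ∈ xs → n ≢ b → n ∈ removeN b xs
∈-removeN⁺ {b = b} p n≢b = ∈-filter⁺ (λ m → ¬? (m ≟ b)) p n≢b

fhn⊆hnames : ∀ {n} P → n ∈ fhn P → n ∈ hnames P
fhn⊆hnames (inHO a x b P) (here e) = here e
fhn⊆hnames (inHO a x b P) (there p) = there (there (fhn⊆hnames P (proj₁ (∈-removeN⁻ _ p))))
fhn⊆hnames (inFO h x P) p = fhn⊆hnames P p
fhn⊆hnames (outHO a e b P) (here e') = here e'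
fhn⊆hnames (outHO a e b P) (there p) = there (there (fhn⊆hnames P (proj₁ (∈-removeN⁻ _ p))))
fhn⊆hnames (outFO h e P) p = fhn⊆hnames P p
fhn⊆hnames (succ w P) p = fhn⊆hnames P p
fhn⊆hnames (repHO a x b P) (here e) = here e
fhn⊆hnames (repHO a x b P) (there p) = there (there (fhn⊆hnames P (proj₁ (∈-removeN⁻ _ p))))
fhn⊆hnames (repFO h x P) p = fhn⊆hnames P p
fhn⊆hnames (P ∣ Q) p with ∈-++⁻ (fhn P) p
... | inj₁ q = ∈-++⁺ˡ (fhn⊆hnames P q)
... | inj₂ q = ∈-++⁺ʳ (hnames P) (fhn⊆hnames Q q)
fhn⊆hnames (νH a P) p = there (fhn⊆hnames P (proj₁ (∈-removeN⁻ _ p)))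
fhn⊆hnames (νF h P) p = fhn⊆hnames P p
fhn⊆hnames nil ()
fhn⊆hnames (P ⊕ Q) p with ∈-++⁻ (fhn P) p
... | inj₁ q = ∈-++⁺ˡ (fhn⊆hnames P q)
... | inj₂ q = ∈-++⁺ʳ (hnames P) (fhn⊆hnames Q q)
fhn⊆hnames (ite e f P Q) p with ∈-++⁻ (fhn P) p
... | inj₁ q = ∈-++⁺ˡ (fhn⊆hnames P q)
... | inj₂ q = ∈-++⁺ʳ (hnames P) (fhn⊆hnames Q q)

∉hnames⇒∉fhn : ∀ {n} P → n ∉ hnames P → n ∉ fhn P
∉hnames⇒∉fhn P n∉ = n∉ ∘ fhn⊆hnames P

fhn-psub : ∀ P x v → fhn (psub P x v) ≡ fhn P
fhn-psub (inHO a y b P) x v with y ≡ᵇ x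
... | true = refl
... | false = cong (λ l → a ∷ removeN b l) (fhn-psub P x v)
fhn-psub (inFO h y P) x v with y ≡ᵇ x
... | true = refl
... | false = fhn-psub P x v
fhn-psub (outHO a e b P) x v = cong (λ l → a ∷ removeN b l) (fhn-psub P x v)
fhn-psub (outFO h e P) x v = fhn-psub P x v
fhn-psub (succ w P) x v = fhn-psub P x v
fhn-psub (repHO a y b P) x v with y ≡ᵇ x
... | true = refl
... | false = cong (λ l → a ∷ removeN b l) (fhn-psub P x v)
fhn-psub (repFO h y P) x v with y ≡ᵇ x
... | true = refl
... | false = fhn-psub P x v
fhn-psub (P ∣ Q) x v = cong₂ _++_ (fhn-psub P x v) (fhn-psub Q x v)
fhn-psub (νH a P) x v = cong (removeN a) (fhn-psub P x v)
fhn-psub (νF h P) x v = fhn-psub P x v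
fhn-psub nil x v = refl
fhn-psub (P ⊕ Q) x v = cong₂ _++_ (fhn-psub P x v) (fhn-psub Q x v)
fhn-psub (ite e f P Q) x v = cong₂ _++_ (fhn-psub P x v) (fhn-psub Q x v)

fhn-fren : ∀ k h P → fhn (fren k h P) ≡ fhn P
fhn-fren k h (inHO a x b P) = cong (λ l → a ∷ removeN b l) (fhn-fren k h P)
fhn-fren k h (inFO h' x P) = fhn-fren k h P
fhn-fren k h (outHO a e b P) = cong (λ l → a ∷ removeN b l) (fhn-fren k h P)
fhn-fren k h (outFO h' e P) = fhn-fren k h P
fhn-fren k h (succ w P) = fhn-fren k h P
fhn-fren k h (repHO a x b P) = cong (λ l → a ∷ removeN b l) (fhn-fren k h P)
fhn-fren k h (repFO h' x P) = fhn-fren k h P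
fhn-fren k h (P ∣ Q) = cong₂ _++_ (fhn-fren k h P) (fhn-fren k h Q)
fhn-fren k h (νH a P) = cong (removeN a) (fhn-fren k h P)
fhn-fren k h (νF h' P) with h' ≡ᵇ h
... | true = refl
... | false = fhn-fren k h P
fhn-fren k h nil = refl
fhn-fren k h (P ⊕ Q) = cong₂ _++_ (fhn-fren k h P) (fhn-fren k h Q)
fhn-fren k h (ite e f P Q) = cong₂ _++_ (fhn-fren k h P) (fhn-fren k h Q)

hren-channel⁻ : ∀ {n} c b a → n ≡ (if a ≡ᵇ b then c else a) → n ≢ c → n ≡ a × n ≢ b
hren-channel⁻ c b a n≡ n≢c with a ≡ᵇ b in a≡ᵇb
... | true  = ⊥-elim (n≢c n≡)
... | false = n≡ , λ n≡b → ≡ᵇ-false⇒≢ a≡ᵇb (trans (sym n≡) n≡b)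

hren-binder⁻ : ∀ {n} c b b' Q → (n ∈ fhn (hren c b Q) → n ≢ c → n ∈ fhn Q × n ≢ b) →
        n ∈ removeN b' (fhn (if b' ≡ᵇ b then Q else hren c b Q)) → n ≢ c →
        n ∈ removeN b' (fhn Q) × n ≢ b
hren-binder⁻ c b b' Q ih p n≢c with b' ≡ᵇ b in b'≡ᵇb
... | true = p , λ n≡b → proj₂ (∈-removeN⁻ (fhn Q) p) (trans n≡b (sym (≡ᵇ-true⇒≡ b'≡ᵇb)))
... | false with ∈-removeN⁻ _ p
...   | q , n≢b' with ih q n≢c
...     | r , n≢b = ∈-removeN⁺ r n≢b' , n≢b

fhn-hren⁻ : ∀ {n} c b P → n ∈ fhn (hren c b P) → n ≢ c → n ∈ fhn P × n ≢ b
fhn-hren⁻ c b (inHO a x b' P) (here e) n≢c with hren-channel⁻ c b a e n≢c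
... | n≡a , n≢b = here n≡a , n≢b
fhn-hren⁻ c b (inHO a x b' P) (there p) n≢c with hren-binder⁻ c b b' P (fhn-hren⁻ c b P) p n≢c
... | q , n≢b = there q , n≢b
fhn-hren⁻ c b (inFO h x P) p n≢c = fhn-hren⁻ c b P p n≢c
fhn-hren⁻ c b (outHO a e b' P) (here e₁) n≢c with hren-channel⁻ c b a e₁ n≢c
... | n≡a , n≢b = here n≡a , n≢b
fhn-hren⁻ c b (outHO a e b' P) (there p) n≢c with hren-binder⁻ c b b' P (fhn-hren⁻ c b P) p n≢c
... | q , n≢b = there q , n≢b
fhn-hren⁻ c b (outFO h e P) p n≢c = fhn-hren⁻ c b P p n≢c
fhn-hren⁻ c b (succ w P) p n≢c = fhn-hren⁻ c b P p n≢c
fhn-hren⁻ c b (repHO a x b' P) (here e) n≢c with hren-channel⁻ c b a e n≢c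
... | n≡a , n≢b = here n≡a , n≢b
fhn-hren⁻ c b (repHO a x b' P) (there p) n≢c with hren-binder⁻ c b b' P (fhn-hren⁻ c b P) p n≢c
... | q , n≢b = there q , n≢b
fhn-hren⁻ c b (repFO h x P) p n≢c = fhn-hren⁻ c b P p n≢c
fhn-hren⁻ c b (P ∣ Q) p n≢c with ∈-++⁻ (fhn (hren c b P)) p
... | inj₁ q = let r , n≢b = fhn-hren⁻ c b P q n≢c in ∈-++⁺ˡ r , n≢b
... | inj₂ q = let r , n≢b = fhn-hren⁻ c b Q q n≢c in ∈-++⁺ʳ (fhn P) r , n≢b
fhn-hren⁻ c b (νH a P) p n≢c = hren-binder⁻ c b a P (fhn-hren⁻ c b P) p n≢c
fhn-hren⁻ c b (νF h P) p n≢c = fhn-hren⁻ c b P p n≢c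
fhn-hren⁻ c b nil () n≢c
fhn-hren⁻ c b (P ⊕ Q) p n≢c with ∈-++⁻ (fhn (hren c b P)) p
... | inj₁ q = let r , n≢b = fhn-hren⁻ c b P q n≢c in ∈-++⁺ˡ r , n≢b
... | inj₂ q = let r , n≢b = fhn-hren⁻ c b Q q n≢c in ∈-++⁺ʳ (fhn P) r , n≢b
fhn-hren⁻ c b (ite e f P Q) p n≢c with ∈-++⁻ (fhn (hren c b P)) p
... | inj₁ q = let r , n≢b = fhn-hren⁻ c b P q n≢c in ∈-++⁺ˡ r , n≢b
... | inj₂ q = let r , n≢b = fhn-hren⁻ c b Q q n≢c in ∈-++⁺ʳ (fhn P) r , n≢b

hren-channel⁺ : ∀ {n} c b a → n ≡ a → n ≢ b → n ≡ (if a ≡ᵇ b then c else a)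
hren-channel⁺ c b a n≡a n≢b with a ≡ᵇ b in a≡ᵇb
... | true  = ⊥-elim (n≢b (trans n≡a (≡ᵇ-true⇒≡ a≡ᵇb)))
... | false = n≡a

hren-binder⁺ : ∀ {n} c b b' Q → (n ∈ fhn Q → n ≢ b → n ∈ fhn (hren c b Q)) →
        n ∈ removeN b' (fhn Q) → n ≢ b →
        n ∈ removeN b' (fhn (if b' ≡ᵇ b then Q else hren c b Q))
hren-binder⁺ c b b' Q ih p n≢b with b' ≡ᵇ b
... | true = p
... | false = ∈-removeN⁺ (ih (proj₁ (∈-removeN⁻ (fhn Q) p)) n≢b) (proj₂ (∈-removeN⁻ (fhn Q) p))

fhn-hren⁺ : ∀ {n} c b P → n ∈ fhn P → n ≢ b → n ∈ fhn (hren c b P)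
fhn-hren⁺ c b (inHO a x b' P) (here e) n≢b = here (hren-channel⁺ c b a e n≢b)
fhn-hren⁺ c b (inHO a x b' P) (there p) n≢b = there (hren-binder⁺ c b b' P (fhn-hren⁺ c b P) p n≢b)
fhn-hren⁺ c b (inFO h x P) p n≢b = fhn-hren⁺ c b P p n≢b
fhn-hren⁺ c b (outHO a e b' P) (here e₁) n≢b = here (hren-channel⁺ c b a e₁ n≢b)
fhn-hren⁺ c b (outHO a e b' P) (there p) n≢b = there (hren-binder⁺ c b b' P (fhn-hren⁺ c b P) p n≢b)
fhn-hren⁺ c b (outFO h e P) p n≢b = fhn-hren⁺ c b P p n≢b
fhn-hren⁺ c b (succ w P) p n≢b = fhn-hren⁺ c b P p n≢b
fhn-hren⁺ c b (repHO a x b' P) (here e) n≢b = here (hren-channel⁺ c b a e n≢b)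
fhn-hren⁺ c b (repHO a x b' P) (there p) n≢b = there (hren-binder⁺ c b b' P (fhn-hren⁺ c b P) p n≢b)
fhn-hren⁺ c b (repFO h x P) p n≢b = fhn-hren⁺ c b P p n≢b
fhn-hren⁺ c b (P ∣ Q) p n≢b with ∈-++⁻ (fhn P) p
... | inj₁ q = ∈-++⁺ˡ (fhn-hren⁺ c b P q n≢b)
... | inj₂ q = ∈-++⁺ʳ (fhn (hren c b P)) (fhn-hren⁺ c b Q q n≢b)
fhn-hren⁺ c b (νH a P) p n≢b = hren-binder⁺ c b a P (fhn-hren⁺ c b P) p n≢b
fhn-hren⁺ c b (νF h P) p n≢b = fhn-hren⁺ c b P p n≢b
fhn-hren⁺ c b nil () n≢b
fhn-hren⁺ c b (P ⊕ Q) p n≢b with ∈-++⁻ (fhn P) p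
... | inj₁ q = ∈-++⁺ˡ (fhn-hren⁺ c b P q n≢b)
... | inj₂ q = ∈-++⁺ʳ (fhn (hren c b P)) (fhn-hren⁺ c b Q q n≢b)
fhn-hren⁺ c b (ite e f P Q) p n≢b with ∈-++⁻ (fhn P) p
... | inj₁ q = ∈-++⁺ˡ (fhn-hren⁺ c b P q n≢b)
... | inj₂ q = ∈-++⁺ʳ (fhn (hren c b P)) (fhn-hren⁺ c b Q q n≢b)

infix 4 _⊆⊇_
_⊆⊇_ : List ℕ → List ℕ → Set
xs ⊆⊇ ys = xs ⊆ ys × ys ⊆ xs

⊆⊇-refl : ∀ {xs} → xs ⊆⊇ xs
⊆⊇-refl = id , id

⊆⊇-sym : ∀ {xs ys} → xs ⊆⊇ ys → ys ⊆⊇ xs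
⊆⊇-sym (f , g) = g , f

⊆⊇-trans : ∀ {xs ys zs} → xs ⊆⊇ ys → ys ⊆⊇ zs → xs ⊆⊇ zs
⊆⊇-trans (f , g) (f' , g') = f' ∘ f , g ∘ g'

⊆⊇-reflexive : ∀ {xs ys} → xs ≡ ys → xs ⊆⊇ ys
⊆⊇-reflexive refl = ⊆⊇-refl

⊆⊇-∷ : ∀ a {xs ys} → xs ⊆⊇ ys → a ∷ xs ⊆⊇ a ∷ ys
⊆⊇-∷ a (f , g) = ∷⁺ʳ a f , ∷⁺ʳ a g

⊆⊇-removeN : ∀ b {xs ys} → xs ⊆⊇ ys → removeN b xs ⊆⊇ removeN b ys
⊆⊇-removeN b {xs} {ys} (f , g) = removeN⁺ f , removeN⁺ g
  where
  removeN⁺ : ∀ {us vs} → us ⊆ vs → removeN b us ⊆ removeN b vs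
  removeN⁺ {us} u⊆v p = let q , n≢b = ∈-removeN⁻ us p in ∈-removeN⁺ (u⊆v q) n≢b

⊆⊇-++ : ∀ {xs ys xs' ys'} → xs ⊆⊇ xs' → ys ⊆⊇ ys' → xs ++ ys ⊆⊇ xs' ++ ys'
⊆⊇-++ (f , g) (f' , g') = ++⁺ f f' , ++⁺ g g'

⊆⊇-hren : ∀ b c P → c ∉ hnames P → removeN b (fhn P) ⊆⊇ removeN c (fhn (hren c b P))
⊆⊇-hren b c P c∉ =
  (λ p → let q , n≢b = ∈-removeN⁻ _ p in
         ∈-removeN⁺ (fhn-hren⁺ c b P q n≢b) (λ e → c∉ (fhn⊆hnames P (subst (_∈ fhn P) e q)))) ,
  (λ p → let q , n≢c = ∈-removeN⁻ _ p in let r , n≢b = fhn-hren⁻ c b P q n≢c in ∈-removeN⁺ r n≢b)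

fhn-≡α : ∀ {P Q} → P ≡α Q → fhn P ⊆⊇ fhn Q
fhn-≡α α-refl = ⊆⊇-refl
fhn-≡α (α-sym p) = ⊆⊇-sym (fhn-≡α p)
fhn-≡α (α-trans p q) = ⊆⊇-trans (fhn-≡α p) (fhn-≡α q)
fhn-≡α (α-inHO {a = a} {b = b} {c = c} {P = P} c∉) = ⊆⊇-∷ a (⊆⊇-hren b c P c∉)
fhn-≡α (α-outHO {a = a} {b = b} {c = c} {P = P} c∉) = ⊆⊇-∷ a (⊆⊇-hren b c P c∉)
fhn-≡α (α-repHO {a = a} {b = b} {c = c} {P = P} c∉) = ⊆⊇-∷ a (⊆⊇-hren b c P c∉)
fhn-≡α (α-νH {b = b} {c = c} {P = P} c∉) = ⊆⊇-hren b c P c∉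
fhn-≡α (α-νF {h = h} {k = k} {P = P} _) = ⊆⊇-reflexive (sym (fhn-fren k h P))
fhn-≡α (c-inHO {a = a} {b = b} p) = ⊆⊇-∷ a (⊆⊇-removeN b (fhn-≡α p))
fhn-≡α (c-inFO p) = fhn-≡α p
fhn-≡α (c-outHO {a = a} {b = b} p) = ⊆⊇-∷ a (⊆⊇-removeN b (fhn-≡α p))
fhn-≡α (c-outFO p) = fhn-≡α p
fhn-≡α (c-succ p) = fhn-≡α p
fhn-≡α (c-repHO {a = a} {b = b} p) = ⊆⊇-∷ a (⊆⊇-removeN b (fhn-≡α p))
fhn-≡α (c-repFO p) = fhn-≡α p
fhn-≡α (c-par p q) = ⊆⊇-++ (fhn-≡α p) (fhn-≡α q)
fhn-≡α (c-νH {a = a} p) = ⊆⊇-removeN a (fhn-≡α p)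
fhn-≡α (c-νF p) = fhn-≡α p
fhn-≡α (c-sum p q) = ⊆⊇-++ (fhn-≡α p) (fhn-≡α q)
fhn-≡α (c-ite p q) = ⊆⊇-++ (fhn-≡α p) (fhn-≡α q)

fhn-prefix : ∀ {n} a b P → n ∈ fhn P → n ∈ a ∷ removeN b (fhn P) ⊎ just b ≡ just n
fhn-prefix {n} a b P p with n ≟ b
... | yes n≡b = inj₂ (cong just (sym n≡b))
... | no n≢b  = inj₁ (there (∈-removeN⁺ p n≢b))

∈-++-idem : ∀ {n : ℕ} xs → n ∈ xs ++ xs → n ∈ xs
∈-++-idem xs p = [ id , id ]′ (∈-++⁻ xs p)

∈-++-residual : ∀ {xs ys xs' ys' : List ℕ} {m₁ m₂ : Maybe ℕ} {n} →
                (n ∈ xs' → n ∈ xs ⊎ m₁ ≡ just n) → (n ∈ ys' → n ∈ ys ⊎ m₂ ≡ just n) →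
                m₁ ≢ just n → m₂ ≢ just n → n ∈ xs' ++ ys' → n ∈ xs ++ ys
∈-++-residual {xs = xs} {xs' = xs'} res₁ res₂ fresh₁ fresh₂ p with ∈-++⁻ xs' p
... | inj₁ q = [ ∈-++⁺ˡ , ⊥-elim ∘ fresh₁ ]′ (res₁ q)
... | inj₂ q = [ ∈-++⁺ʳ xs , ⊥-elim ∘ fresh₂ ]′ (res₂ q)

fhn-step : ∀ {P μ P' n} → P —[ μ ]→ P' → n ∈ fhn P' → n ∈ fhn P ⊎ bn μ ≡ just n
fhn-step (t-inHO {a = a} {x = x} {b = b} {P = P} {v = v}) p =
  fhn-prefix a b P (subst (_ ∈_) (fhn-psub P x v) p)
fhn-step (t-outHO {a = a} {b = b} {P = P} _) p = fhn-prefix a b P p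
fhn-step (t-inFO {x = x} {P = P} {v = v}) p = inj₁ (subst (_ ∈_) (fhn-psub P x v) p)
fhn-step (t-outFO _) p = inj₁ p
fhn-step t-succ ()
fhn-step (t-repHO s) p = ⊎-map₁ (∈-++-idem _) (fhn-step s p)
fhn-step (t-repFO s) p = ⊎-map₁ (∈-++-idem _) (fhn-step s p)
fhn-step (t-νH {P' = P'} s _) p =
  let q , n≢a = ∈-removeN⁻ (fhn P') p in ⊎-map₁ (λ r → ∈-removeN⁺ r n≢a) (fhn-step s q)
fhn-step (t-νF s _) p = fhn-step s p
fhn-step (t-sumL s) p = ⊎-map₁ ∈-++⁺ˡ (fhn-step s p)
fhn-step (t-sumR {P = P} s) p = ⊎-map₁ (∈-++⁺ʳ (fhn P)) (fhn-step s p)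
fhn-step (t-then _ _ s) p = ⊎-map₁ ∈-++⁺ˡ (fhn-step s p)
fhn-step (t-else {P = P} _ _ _ s) p = ⊎-map₁ (∈-++⁺ʳ (fhn P)) (fhn-step s p)
fhn-step (t-commHO-l {P' = P'} {Q' = Q'} s₁ s₂) p =
  let q , n≢b = ∈-removeN⁻ (fhn P' ++ fhn Q') p
  in inj₁ (∈-++-residual (fhn-step s₁) (fhn-step s₂) (n≢b ∘ sym ∘ M.just-injective)
                    (n≢b ∘ sym ∘ M.just-injective) q)
fhn-step (t-commHO-r {P' = P'} {Q' = Q'} s₁ s₂) p =
  let q , n≢b = ∈-removeN⁻ (fhn P' ++ fhn Q') p
  in inj₁ (∈-++-residual (fhn-step s₁) (fhn-step s₂) (n≢b ∘ sym ∘ M.just-injective)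
                    (n≢b ∘ sym ∘ M.just-injective) q)
fhn-step (t-commFO-l s₁ s₂) p = inj₁ (∈-++-residual (fhn-step s₁) (fhn-step s₂) (λ ()) (λ ()) p)
fhn-step (t-commFO-r s₁ s₂) p = inj₁ (∈-++-residual (fhn-step s₁) (fhn-step s₂) (λ ()) (λ ()) p)
fhn-step (t-parL {P' = P'} s _) p with ∈-++⁻ (fhn P') p
... | inj₁ q = ⊎-map₁ ∈-++⁺ˡ (fhn-step s q)
... | inj₂ q = inj₁ (∈-++⁺ʳ _ q)
fhn-step (t-parR {P = P} s _) p with ∈-++⁻ (fhn P) p
... | inj₁ q = inj₁ (∈-++⁺ˡ q)
... | inj₂ q = ⊎-map₁ (∈-++⁺ʳ (fhn P)) (fhn-step s q)
fhn-step (t-α P≡αP' s) p = ⊎-map₁ (proj₂ (fhn-≡α P≡αP')) (fhn-step s p)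

hren-channel≡transpose : ∀ z c a → a ≢ z → (if a ≡ᵇ c then z else a) ≡ transpose z c a
hren-channel≡transpose z c a a≢z with transpose-view z c a
... | at-x a≡z = ⊥-elim (a≢z a≡z)
... | at-y _ refl rewrite ≡ᵇ-refl a = sym (transpose-ʳ z a)
... | elsewhere a≢z′ a≢c rewrite ≢⇒≡ᵇ-false a≢c = sym (transpose-other z c a a≢z′ a≢c)

transpose-channel : ∀ x y a {xs} → x ∉ a ∷ xs → y ∉ a ∷ xs → transpose x y a ≡ a
transpose-channel x y a x∉ y∉ = transpose-other x y a (∉∷⇒≢ x∉) (∉∷⇒≢ y∉)

record Binder : Set where
  field
    bind        : ℕ → Proc → Proc
    bind-rename : ∀ {b c P} → c ∉ hnames P → bind b P ≡α bind c (hren c b P)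
    bind-cong   : ∀ {b P P'} → P ≡α P' → bind b P ≡α bind b P'

inHOᴮ : Name → Var → Binder
inHOᴮ a x = record { bind = inHO a x ; bind-rename = α-inHO ; bind-cong = c-inHO }

outHOᴮ : Name → Expr → Binder
outHOᴮ a e = record { bind = outHO a e ; bind-rename = α-outHO ; bind-cong = c-outHO }

repHOᴮ : Name → Var → Binder
repHOᴮ a x = record { bind = repHO a x ; bind-rename = α-repHO ; bind-cong = c-repHO }

νHᴮ : Binder
νHᴮ = record { bind = νH ; bind-rename = α-νH ; bind-cong = c-νH }

module _ (B : Binder) where
  open Binder B

  bind-hren≡α-rename-transpose : ∀ z c b P → b ≢ z → z ∉ hnames P →
    hren z c P ≡α rename (transpose z c) P →
    bind b (if b ≡ᵇ c then P else hren z c P) ≡α bind (transpose z c b) (rename (transpose z c) P)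
  bind-hren≡α-rename-transpose z c b P b≢z z∉ ih with b ≟ c
  ... | yes refl rewrite ≡ᵇ-refl b | transpose-ʳ z b = α-trans (bind-rename z∉) (bind-cong ih)
  ... | no b≢c rewrite ≢⇒≡ᵇ-false b≢c | transpose-other z c b b≢z b≢c = bind-cong ih

hren≡α-rename-transpose : ∀ z c P → z ∉ hnames P → hren z c P ≡α rename (transpose z c) P
hren≡α-rename-transpose z c (inHO a x b P) z∉ rewrite hren-channel≡transpose z c a (∉∷⇒≢ z∉) =
  bind-hren≡α-rename-transpose (inHOᴮ _ x) z c b P (∉∷⇒≢ (∉∷⇒∉ z∉)) (∉∷⇒∉ (∉∷⇒∉ z∉))
    (hren≡α-rename-transpose z c P (∉∷⇒∉ (∉∷⇒∉ z∉)))
hren≡α-rename-transpose z c (outHO a e b P) z∉ rewrite hren-channel≡transpose z c a (∉∷⇒≢ z∉) =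
  bind-hren≡α-rename-transpose (outHOᴮ _ e) z c b P (∉∷⇒≢ (∉∷⇒∉ z∉)) (∉∷⇒∉ (∉∷⇒∉ z∉))
    (hren≡α-rename-transpose z c P (∉∷⇒∉ (∉∷⇒∉ z∉)))
hren≡α-rename-transpose z c (repHO a x b P) z∉ rewrite hren-channel≡transpose z c a (∉∷⇒≢ z∉) =
  bind-hren≡α-rename-transpose (repHOᴮ _ x) z c b P (∉∷⇒≢ (∉∷⇒∉ z∉)) (∉∷⇒∉ (∉∷⇒∉ z∉))
    (hren≡α-rename-transpose z c P (∉∷⇒∉ (∉∷⇒∉ z∉)))
hren≡α-rename-transpose z c (νH a P) z∉ =
  bind-hren≡α-rename-transpose νHᴮ z c a P (∉∷⇒≢ z∉) (∉∷⇒∉ z∉) (hren≡α-rename-transpose z c P (∉∷⇒∉ z∉))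
hren≡α-rename-transpose z c (inFO h x P) z∉ = c-inFO (hren≡α-rename-transpose z c P z∉)
hren≡α-rename-transpose z c (outFO h e P) z∉ = c-outFO (hren≡α-rename-transpose z c P z∉)
hren≡α-rename-transpose z c (succ w P) z∉ = c-succ (hren≡α-rename-transpose z c P z∉)
hren≡α-rename-transpose z c (repFO h x P) z∉ = c-repFO (hren≡α-rename-transpose z c P z∉)
hren≡α-rename-transpose z c (νF h P) z∉ = c-νF (hren≡α-rename-transpose z c P z∉)
hren≡α-rename-transpose z c nil z∉ = α-refl
hren≡α-rename-transpose z c (P ∣ Q) z∉ =
  c-par (hren≡α-rename-transpose z c P (∉++⇒∉ˡ (hnames P) z∉))
        (hren≡α-rename-transpose z c Q (∉++⇒∉ʳ (hnames P) z∉))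
hren≡α-rename-transpose z c (P ⊕ Q) z∉ =
  c-sum (hren≡α-rename-transpose z c P (∉++⇒∉ˡ (hnames P) z∉))
        (hren≡α-rename-transpose z c Q (∉++⇒∉ʳ (hnames P) z∉))
hren≡α-rename-transpose z c (ite e f P Q) z∉ =
  c-ite (hren≡α-rename-transpose z c P (∉++⇒∉ˡ (hnames P) z∉))
        (hren≡α-rename-transpose z c Q (∉++⇒∉ʳ (hnames P) z∉))

TransposeInvariant : Proc → Set
TransposeInvariant S = ∀ x y → x ≢ y → x ∉ fhn S → y ∉ fhn S → rename (transpose x y) S ≡α S

module _ (B : Binder) where
  open Binder B

  -- Move the bound name through a third name w fresh for x, y and S.
  bind-transpose-bound : ∀ x y S → x ≢ y → TransposeInvariant S → y ∉ fhn S →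
                    bind y (rename (transpose x y) S) ≡α bind x S
  bind-transpose-bound x y S x≢y ih y∉S with fresh (x ∷ y ∷ hnames S)
  ... | w , w∉ =
    α-trans to-w (α-trans (subst (bind w R ≡α_) (cong (bind w) reorder) α-refl)
                          (α-trans (bind-cong drop-y) (α-sym from-w)))
    where
    w≢x : w ≢ x
    w≢x = w∉ ∘ here
    w≢y : w ≢ y
    w≢y = w∉ ∘ there ∘ here
    w∉S : w ∉ hnames S
    w∉S = w∉ ∘ there ∘ there
    R : Proc
    R = rename (transpose w y) (rename (transpose x y) S)
    w∉xyS : w ∉ hnames (rename (transpose x y) S)
    w∉xyS = subst (_∉ hnames (rename (transpose x y) S)) (transpose-other x y w w≢x w≢y)
                  (∉hnames-rename (transpose-injective x y) S w∉S)
    from-w : bind x S ≡α bind w (rename (transpose w x) S)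
    from-w = α-trans (bind-rename w∉S) (bind-cong (hren≡α-rename-transpose w x S w∉S))
    to-w : bind y (rename (transpose x y) S) ≡α bind w R
    to-w = α-trans (bind-rename w∉xyS) (bind-cong (hren≡α-rename-transpose w y _ w∉xyS))
    reorder : R ≡ rename (transpose w x) (rename (transpose y w) S)
    reorder = trans (rename-∘ (transpose w y) (transpose x y) S)
      (trans (rename-ext (transpose-triangle x y w x≢y w≢x w≢y) S)
             (sym (rename-∘ (transpose w x) (transpose y w) S)))
    drop-y : rename (transpose w x) (rename (transpose y w) S) ≡α rename (transpose w x) S
    drop-y = rename-≡α (transpose-injective w x) (ih y w (w≢y ∘ sym) y∉S (∉hnames⇒∉fhn S w∉S))

  bind-transpose-nonfree-≡α : ∀ x y b S → x ≢ y → TransposeInvariant S →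
                         x ∉ removeN b (fhn S) → y ∉ removeN b (fhn S) →
                         bind (transpose x y b) (rename (transpose x y) S) ≡α bind b S
  bind-transpose-nonfree-≡α x y b S x≢y ih x∉ y∉ with transpose-view x y b
  ... | at-x refl rewrite transpose-ˡ b y =
    bind-transpose-bound b y S x≢y ih (λ p → y∉ (∈-removeN⁺ p (x≢y ∘ sym)))
  ... | at-y _ refl rewrite transpose-ʳ x b | rename-ext (transpose-comm x b) S =
    bind-transpose-bound b x S (x≢y ∘ sym) ih (λ p → x∉ (∈-removeN⁺ p x≢y))
  ... | elsewhere b≢x b≢y rewrite transpose-other x y b b≢x b≢y =
    bind-cong (ih x y x≢y (λ p → x∉ (∈-removeN⁺ p (b≢x ∘ sym))) (λ p → y∉ (∈-removeN⁺ p (b≢y ∘ sym))))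

transpose-nonfree-≡α : ∀ x y S → x ∉ fhn S → y ∉ fhn S → rename (transpose x y) S ≡α S
transpose-nonfree-≡α x y S x∉ y∉ with x ≟ y
... | yes refl = subst (_≡α S) (sym (trans (rename-ext (transpose-same x) S) (rename-id S))) α-refl
... | no x≢y = transpose-invariant S x y x≢y x∉ y∉
  where
  transpose-invariant : ∀ S → TransposeInvariant S
  transpose-invariant (inHO a x′ b S) x y x≢y x∉ y∉ rewrite transpose-channel x y a x∉ y∉ =
    bind-transpose-nonfree-≡α (inHOᴮ a x′) x y b S x≢y (transpose-invariant S) (∉∷⇒∉ x∉) (∉∷⇒∉ y∉)
  transpose-invariant (outHO a e b S) x y x≢y x∉ y∉ rewrite transpose-channel x y a x∉ y∉ =
    bind-transpose-nonfree-≡α (outHOᴮ a e) x y b S x≢y (transpose-invariant S) (∉∷⇒∉ x∉) (∉∷⇒∉ y∉)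
  transpose-invariant (repHO a x′ b S) x y x≢y x∉ y∉ rewrite transpose-channel x y a x∉ y∉ =
    bind-transpose-nonfree-≡α (repHOᴮ a x′) x y b S x≢y (transpose-invariant S) (∉∷⇒∉ x∉) (∉∷⇒∉ y∉)
  transpose-invariant (νH b S) x y x≢y x∉ y∉ =
    bind-transpose-nonfree-≡α νHᴮ x y b S x≢y (transpose-invariant S) x∉ y∉
  transpose-invariant (inFO h x′ S) x y x≢y x∉ y∉ = c-inFO (transpose-invariant S x y x≢y x∉ y∉)
  transpose-invariant (outFO h e S) x y x≢y x∉ y∉ = c-outFO (transpose-invariant S x y x≢y x∉ y∉)
  transpose-invariant (succ w S) x y x≢y x∉ y∉ = c-succ (transpose-invariant S x y x≢y x∉ y∉)
  transpose-invariant (repFO h x′ S) x y x≢y x∉ y∉ = c-repFO (transpose-invariant S x y x≢y x∉ y∉)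
  transpose-invariant (νF h S) x y x≢y x∉ y∉ = c-νF (transpose-invariant S x y x≢y x∉ y∉)
  transpose-invariant nil x y x≢y x∉ y∉ = α-refl
  transpose-invariant (P ∣ Q) x y x≢y x∉ y∉ =
    c-par (transpose-invariant P x y x≢y (∉++⇒∉ˡ (fhn P) x∉) (∉++⇒∉ˡ (fhn P) y∉))
          (transpose-invariant Q x y x≢y (∉++⇒∉ʳ (fhn P) x∉) (∉++⇒∉ʳ (fhn P) y∉))
  transpose-invariant (P ⊕ Q) x y x≢y x∉ y∉ =
    c-sum (transpose-invariant P x y x≢y (∉++⇒∉ˡ (fhn P) x∉) (∉++⇒∉ˡ (fhn P) y∉))
          (transpose-invariant Q x y x≢y (∉++⇒∉ʳ (fhn P) x∉) (∉++⇒∉ʳ (fhn P) y∉))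
  transpose-invariant (ite e f P Q) x y x≢y x∉ y∉ =
    c-ite (transpose-invariant P x y x≢y (∉++⇒∉ˡ (fhn P) x∉) (∉++⇒∉ˡ (fhn P) y∉))
          (transpose-invariant Q x y x≢y (∉++⇒∉ʳ (fhn P) x∉) (∉++⇒∉ʳ (fhn P) y∉))

tag : Proc → ℕ
tag (inHO _ _ _ _) = 0
tag (inFO _ _ _) = 1
tag (outHO _ _ _ _) = 2
tag (outFO _ _ _) = 3
tag (succ _ _) = 4
tag (repHO _ _ _ _) = 5
tag (repFO _ _ _) = 6
tag (_ ∣ _) = 7
tag (νH _ _) = 8
tag (νF _ _) = 9
tag nil = 10
tag (_ ⊕ _) = 11
tag (ite _ _ _ _) = 12

tag-≡α : ∀ {P Q} → P ≡α Q → tag P ≡ tag Q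
tag-≡α α-refl = refl
tag-≡α (α-sym p) = sym (tag-≡α p)
tag-≡α (α-trans p q) = trans (tag-≡α p) (tag-≡α q)
tag-≡α (α-inHO _) = refl
tag-≡α (α-outHO _) = refl
tag-≡α (α-repHO _) = refl
tag-≡α (α-νH _) = refl
tag-≡α (α-νF _) = refl
tag-≡α (c-inHO _) = refl
tag-≡α (c-inFO _) = refl
tag-≡α (c-outHO _) = refl
tag-≡α (c-outFO _) = refl
tag-≡α (c-succ _) = refl
tag-≡α (c-repHO _) = refl
tag-≡α (c-repFO _) = refl
tag-≡α (c-par _ _) = refl
tag-≡α (c-νH _) = refl
tag-≡α (c-νF _) = refl
tag-≡α (c-sum _ _) = refl
tag-≡α (c-ite _ _) = refl

tag≡8⇒νH : ∀ U → tag U ≡ 8 → ∃₂ λ e W → U ≡ νH e W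
tag≡8⇒νH (νH e W) _ = e , W , refl
tag≡8⇒νH (inHO _ _ _ _) ()
tag≡8⇒νH (inFO _ _ _) ()
tag≡8⇒νH (outHO _ _ _ _) ()
tag≡8⇒νH (outFO _ _ _) ()
tag≡8⇒νH (succ _ _) ()
tag≡8⇒νH (repHO _ _ _ _) ()
tag≡8⇒νH (repFO _ _ _) ()
tag≡8⇒νH (_ ∣ _) ()
tag≡8⇒νH (νF _ _) ()
tag≡8⇒νH nil ()
tag≡8⇒νH (_ ⊕ _) ()
tag≡8⇒νH (ite _ _ _ _) ()

≡α-νH-shape : ∀ {P a Q} → P ≡α νH a Q → ∃₂ λ b R → P ≡ νH b R
≡α-νH-shape {P} P≡α = tag≡8⇒νH P (tag-≡α P≡α)

rename-transpose-∘ : ∀ z w d P → z ∉ hnames P → w ∉ hnames P →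
                     rename (transpose z w) (rename (transpose w d) P) ≡ rename (transpose z d) P
rename-transpose-∘ z w d P z∉ w∉ = trans (rename-∘ (transpose z w) (transpose w d) P)
  (rename-agree P (λ p → transpose-∘-transpose z w d _ (λ e → z∉ (subst (_∈ hnames P) e p))
                                                       (λ e → w∉ (subst (_∈ hnames P) e p))))

rename-transpose-involutive : ∀ z a P → rename (transpose z a) (rename (transpose z a) P) ≡ P
rename-transpose-involutive z a P =
  trans (rename-∘ (transpose z a) (transpose z a) P)
        (trans (rename-ext (transpose-involutive z a) P) (rename-id P))

νH-≡α-inversion : ∀ {S T} → S ≡α T → ∀ {d X a Y} → S ≡ νH d X → T ≡ νH a Y →
                  ∀ z → z ∉ hnames X → z ∉ hnames Y → z ≢ d → z ≢ a →
                  rename (transpose z d) X ≡α rename (transpose z a) Y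
νH-≡α-inversion α-refl refl refl z _ _ _ _ = α-refl
νH-≡α-inversion (α-sym p) S≡ T≡ z z∉X z∉Y z≢d z≢a = α-sym (νH-≡α-inversion p T≡ S≡ z z∉Y z∉X z≢a z≢d)
νH-≡α-inversion (α-trans {Q = U} p q) {d} {X} {a} {Y} refl refl z z∉X z∉Y z≢d z≢a
  with ≡α-νH-shape (α-sym p)
... | e , W , refl with fresh (z ∷ d ∷ a ∷ e ∷ hnames X ++ hnames Y ++ hnames W)
...   | w , w∉ =
  subst₂ _≡α_ (rename-transpose-∘ z w d X z∉X w∉X) (rename-transpose-∘ z w a Y z∉Y w∉Y)
         (rename-≡α (transpose-injective z w) via-W)
  where
  w∉names : w ∉ hnames X ++ hnames Y ++ hnames W
  w∉names = w∉ ∘ there ∘ there ∘ there ∘ there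
  w∉X : w ∉ hnames X
  w∉X = ∉++⇒∉ˡ (hnames X) w∉names
  w∉Y : w ∉ hnames Y
  w∉Y = ∉++⇒∉ˡ (hnames Y) (∉++⇒∉ʳ (hnames X) w∉names)
  w∉W : w ∉ hnames W
  w∉W = ∉++⇒∉ʳ (hnames Y) (∉++⇒∉ʳ (hnames X) w∉names)
  via-W : rename (transpose w d) X ≡α rename (transpose w a) Y
  via-W = α-trans
    (νH-≡α-inversion p refl refl w w∉X w∉W (w∉ ∘ there ∘ here) (w∉ ∘ there ∘ there ∘ there ∘ here))
    (νH-≡α-inversion q refl refl w w∉W w∉Y (w∉ ∘ there ∘ there ∘ there ∘ here) (w∉ ∘ there ∘ there ∘ here))
νH-≡α-inversion (α-νH {b = b} {c = c} {P = P} c∉) refl refl z z∉X _ _ _ =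
  α-sym (subst (rename (transpose z c) (hren c b P) ≡α_) (rename-transpose-∘ z c b P z∉X c∉)
               (rename-≡α (transpose-injective z c) (hren≡α-rename-transpose c b P c∉)))
νH-≡α-inversion (c-νH {a = a} p) refl refl z _ _ _ _ = rename-≡α (transpose-injective z a) p
νH-≡α-inversion (α-inHO _) () _ _ _ _ _ _
νH-≡α-inversion (α-outHO _) () _ _ _ _ _ _
νH-≡α-inversion (α-repHO _) () _ _ _ _ _ _
νH-≡α-inversion (α-νF _) () _ _ _ _ _ _
νH-≡α-inversion (c-inHO _) () _ _ _ _ _ _
νH-≡α-inversion (c-inFO _) () _ _ _ _ _ _
νH-≡α-inversion (c-outHO _) () _ _ _ _ _ _
νH-≡α-inversion (c-outFO _) () _ _ _ _ _ _
νH-≡α-inversion (c-succ _) () _ _ _ _ _ _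
νH-≡α-inversion (c-repHO _) () _ _ _ _ _ _
νH-≡α-inversion (c-repFO _) () _ _ _ _ _ _
νH-≡α-inversion (c-par _ _) () _ _ _ _ _ _
νH-≡α-inversion (c-νF _) () _ _ _ _ _ _
νH-≡α-inversion (c-sum _ _) () _ _ _ _ _ _
νH-≡α-inversion (c-ite _ _) () _ _ _ _ _ _

renameAct-fix : ∀ f μ → (∀ {n} → n ∈ actH μ → f n ≡ n) → renameAct f μ ≡ μ
renameAct-fix f τ _ = refl
renameAct-fix f (inA a v b) fix = cong₂ (λ u w → inA u v w) (fix (here refl)) (fix (there (here refl)))
renameAct-fix f (outA a v b) fix = cong₂ (λ u w → outA u v w) (fix (here refl)) (fix (there (here refl)))
renameAct-fix f (inF h v) _ = refl
renameAct-fix f (outF h v) _ = refl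
renameAct-fix f (ok w) _ = refl

bn∈actH : ∀ μ {b} → bn μ ≡ just b → b ∈ actH μ
bn∈actH (inA a v b) refl = there (here refl)
bn∈actH (outA a v b) refl = there (here refl)

νH-step-inversion : ∀ {R μ R'} → R —[ μ ]→ R' → ∀ {a P} → R ≡α νH a P → a ∉ actH μ →
                    ∃ λ P' → (P —[ μ ]→ P') × (R' ≡α νH a P')
νH-step-inversion s R≡α with ≡α-νH-shape R≡α
... | _ , _ , refl = restriction-step-inversion s R≡α
  where
  restriction-step-inversion : ∀ {d P₁ μ R'} → νH d P₁ —[ μ ]→ R' → ∀ {a P} → νH d P₁ ≡α νH a P →
                               a ∉ actH μ → ∃ λ P' → (P —[ μ ]→ P') × (R' ≡α νH a P')
  restriction-step-inversion (t-α p s) R≡α a∉μ = νH-step-inversion s (α-trans (α-sym p) R≡α) a∉μ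
  restriction-step-inversion {d} {P₁} {μ} (t-νH {P' = P₁'} s d∉μ) {a} {P} R≡α a∉μ
    with fresh (d ∷ a ∷ actH μ ++ hnames P₁ ++ hnames P₁' ++ hnames P)
  ... | z , z∉ = P' , t-α P≡α step′ , α-sym after≡α
    where
    z∉names : z ∉ actH μ ++ hnames P₁ ++ hnames P₁' ++ hnames P
    z∉names = z∉ ∘ there ∘ there
    z∉μ : z ∉ actH μ
    z∉μ = ∉++⇒∉ˡ (actH μ) z∉names
    z∉P₁ : z ∉ hnames P₁
    z∉P₁ = ∉++⇒∉ˡ (hnames P₁) (∉++⇒∉ʳ (actH μ) z∉names)
    z∉P₁' : z ∉ hnames P₁'
    z∉P₁' = ∉++⇒∉ˡ (hnames P₁') (∉++⇒∉ʳ (hnames P₁) (∉++⇒∉ʳ (actH μ) z∉names))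
    z∉P : z ∉ hnames P
    z∉P = ∉++⇒∉ʳ (hnames P₁') (∉++⇒∉ʳ (hnames P₁) (∉++⇒∉ʳ (actH μ) z∉names))
    π : Proc → Proc
    π = rename (transpose z a) ∘ rename (transpose z d)
    P' : Proc
    P' = π P₁'
    P≡α : P ≡α π P₁
    P≡α = subst (_≡α π P₁) (rename-transpose-involutive z a P)
            (rename-≡α (transpose-injective z a)
              (α-sym (νH-≡α-inversion R≡α refl refl z z∉P₁ z∉P (z∉ ∘ here) (z∉ ∘ there ∘ here))))
    π-fixes-μ : renameAct (transpose z a) (renameAct (transpose z d) μ) ≡ μ
    π-fixes-μ = trans (cong (renameAct (transpose z a))
                            (renameAct-fix (transpose z d) μ (transpose-fix-∉ z d z∉μ d∉μ)))
                      (renameAct-fix (transpose z a) μ (transpose-fix-∉ z a z∉μ a∉μ))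
    step′ : π P₁ —[ μ ]→ P'
    step′ = subst (λ m → _ —[ m ]→ _) π-fixes-μ
              (rename-step (transpose-injective z a) (rename-step (transpose-injective z d) s))
    z∉after : z ∉ fhn (νH d P₁')
    z∉after p = z∉P₁' (fhn⊆hnames P₁' (proj₁ (∈-removeN⁻ (fhn P₁') p)))
    d∉after : d ∉ fhn (νH d P₁')
    d∉after p = proj₂ (∈-removeN⁻ (fhn P₁') p) refl
    a∉after : a ∉ fhn (νH d P₁')
    a∉after p with fhn-step (t-νH s d∉μ) p
    ... | inj₁ q = proj₂ (∈-removeN⁻ (fhn P) (proj₁ (fhn-≡α R≡α) q)) refl
    ... | inj₂ e = a∉μ (bn∈actH μ e)
    π-after : π (νH d P₁') ≡ νH a P'
    π-after rewrite transpose-ʳ z d | transpose-ˡ z a = refl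
    after≡α : νH a P' ≡α νH d P₁'
    after≡α = subst (_≡α νH d P₁') π-after
      (α-trans (rename-≡α (transpose-injective z a) (transpose-nonfree-≡α z d _ z∉after d∉after))
               (transpose-nonfree-≡α z a _ z∉after a∉after))

infix 4 _≐_
_≐_ : VF → VF → Set
G ≐ G' = ∀ k → G k ≡ G' k

≐-refl : ∀ {G} → G ≐ G
≐-refl k = refl

≐-sym : ∀ {G G'} → G ≐ G' → G' ≐ G
≐-sym e k = sym (e k)

≐-trans : ∀ {G G' G''} → G ≐ G' → G' ≐ G'' → G ≐ G''
≐-trans e e' k = trans (e k) (e' k)

-- The observer updates of al-outHO and al-inHO.
afterOut : VF → Name → Name → VF
afterOut G c b = upd G cur (get G (hn c) ∷ʳ b)

afterIn : VF → Name → VF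
afterIn G b = upd (G ∖ cur) (hn b) (get G cur ∷ʳ b)

hn-injective : ∀ {m n} → hn m ≡ hn n → m ≡ n
hn-injective refl = refl

hn≢ : ∀ {m n} → m ≢ n → hn m ≢ hn n
hn≢ m≢n = m≢n ∘ hn-injective

cur≢hn : ∀ {n} → cur ≢ hn n
cur≢hn ()

hn≢cur : ∀ {n} → hn n ≢ cur
hn≢cur ()

upd-self : ∀ G k V → upd G k V k ≡ just V
upd-self G k V with k ≟K k
... | yes _  = refl
... | no k≢k = ⊥-elim (k≢k refl)

upd-other : ∀ G k V k' → k' ≢ k → upd G k V k' ≡ G k'
upd-other G k V k' k'≢k with k' ≟K k
... | yes k'≡k = ⊥-elim (k'≢k k'≡k)
... | no _     = refl

upd-cong : ∀ {G G'} k {V V'} → G ≐ G' → V ≡ V' → upd G k V ≐ upd G' k V'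
upd-cong k e refl k' with k' ≟K k
... | yes _ = refl
... | no _  = e k'

without : Key → List Name → List Name
without k = filter (λ n → ¬? (hn n ≟K k))

without-cur : ∀ xs → without cur xs ≡ xs
without-cur []       = refl
without-cur (x ∷ xs) = cong (x ∷_) (without-cur xs)

without-∷ʳ : ∀ a xs b → b ≢ a → without (hn a) (xs ∷ʳ b) ≡ without (hn a) xs ∷ʳ b
without-∷ʳ a [] b b≢a with hn b ≟K hn a
... | yes hb≡ha = ⊥-elim (b≢a (hn-injective hb≡ha))
... | no _      = refl
without-∷ʳ a (x ∷ xs) b b≢a with hn x ≟K hn a
... | yes _ = without-∷ʳ a xs b b≢a
... | no _  = cong (x ∷_) (without-∷ʳ a xs b b≢a)

∈-without⁻ : ∀ {n} a xs → n ∈ without (hn a) xs → n ∈ xs × n ≢ a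
∈-without⁻ a xs p =
  let q , n≢a = ∈-filter⁻ (λ m → ¬? (hn m ≟K hn a)) {xs = xs} p in q , n≢a ∘ cong hn

∈-without⁺ : ∀ {n} a xs → n ∈ xs → n ≢ a → n ∈ without (hn a) xs
∈-without⁺ a xs p n≢a = ∈-filter⁺ (λ m → ¬? (hn m ≟K hn a)) p (n≢a ∘ hn-injective)

∖-val : ∀ G k k' → k' ≢ k → (G ∖ k) k' ≡ M.map (without k) (G k')
∖-val G k k' k'≢k with k' ≟K k
... | yes k'≡k = ⊥-elim (k'≢k k'≡k)
... | no _     = refl

∖-self : ∀ G k → (G ∖ k) k ≡ nothing
∖-self G k with k ≟K k
... | yes _  = refl
... | no k≢k = ⊥-elim (k≢k refl)

∖-cong : ∀ {G G'} k → G ≐ G' → G ∖ k ≐ G' ∖ k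
∖-cong k e k' with k' ≟K k
... | yes _ = refl
... | no _  = cong (M.map (without k)) (e k')

∖cur-hn : ∀ G n → (G ∖ cur) (hn n) ≡ G (hn n)
∖cur-hn G n =
  trans (∖-val G cur (hn n) hn≢cur) (trans (M.map-cong without-cur (G (hn n))) (M.map-id (G (hn n))))

∖-∖-comm : ∀ G a → (G ∖ cur) ∖ hn a ≐ (G ∖ hn a) ∖ cur
∖-∖-comm G a cur =
  trans (∖-val (G ∖ cur) (hn a) cur cur≢hn)
        (trans (cong (M.map (without (hn a))) (∖-self G cur)) (sym (∖-self (G ∖ hn a) cur)))
∖-∖-comm G a (hn n) with n ≟ a
... | yes refl = refl
... | no _ = trans (cong (M.map (without (hn a))) (∖cur-hn G n))
                   (sym (trans (M.map-cong without-cur (M.map (without (hn a)) (G (hn n))))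
                              (M.map-id (M.map (without (hn a)) (G (hn n))))))

∖-upd : ∀ G k V a → k ≢ hn a → upd G k V ∖ hn a ≐ upd (G ∖ hn a) k (without (hn a) V)
∖-upd G k V a k≢a k' with k' ≟K hn a
... | yes refl = sym (trans (upd-other (G ∖ hn a) k _ (hn a) (k≢a ∘ sym)) (∖-self G (hn a)))
... | no k'≢a with k' ≟K k
...   | yes _ = refl
...   | no _  = sym (∖-val G (hn a) k' k'≢a)

fromMaybe-map : ∀ (f : List Name → List Name) (m : Maybe (List Name)) → f [] ≡ [] →
                M.fromMaybe [] (M.map f m) ≡ f (M.fromMaybe [] m)
fromMaybe-map f nothing  f[]≡[] = sym f[]≡[]
fromMaybe-map f (just _) _      = refl

get-≐ : ∀ {G G'} k → G ≐ G' → get G k ≡ get G' k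
get-≐ k e = cong (M.fromMaybe []) (e k)

get-∖ : ∀ G a k → k ≢ hn a → get (G ∖ hn a) k ≡ without (hn a) (get G k)
get-∖ G a k k≢a = trans (cong (M.fromMaybe []) (∖-val G (hn a) k k≢a)) (fromMaybe-map _ (G k) refl)

afterOut-∖ : ∀ {Gν G} a c b → Gν ≐ G ∖ hn a → c ≢ a → b ≢ a →
             afterOut Gν c b ≐ afterOut G c b ∖ hn a
afterOut-∖ {Gν} {G} a c b e c≢a b≢a =
  ≐-trans (upd-cong cur e
            (trans (cong (_∷ʳ b) (trans (get-≐ (hn c) e) (get-∖ G a (hn c) (hn≢ c≢a))))
                   (sym (without-∷ʳ a (get G (hn c)) b b≢a))))
          (≐-sym (∖-upd G cur _ a cur≢hn))

afterIn-∖ : ∀ {Gν G} a b → Gν ≐ G ∖ hn a → b ≢ a → afterIn Gν b ≐ afterIn G b ∖ hn a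
afterIn-∖ {Gν} {G} a b e b≢a =
  ≐-trans (upd-cong (hn b) (≐-trans (∖-cong cur e) (≐-sym (∖-∖-comm G a)))
            (trans (cong (_∷ʳ b) (trans (get-≐ cur e) (get-∖ G a cur cur≢hn)))
                   (sym (without-∷ʳ a (get G cur) b b≢a))))
          (≐-sym (∖-upd (G ∖ cur) (hn b) _ a (hn≢ b≢a)))

permuteKey : (ℕ → ℕ) → Key → Key
permuteKey f cur    = cur
permuteKey f (hn n) = hn (f n)

-- An action on observers only when f is an involution: keys are looked up at f k, not f⁻¹ k.
permuteVF : (ℕ → ℕ) → VF → VF
permuteVF f G k = M.map (map f) (G (permuteKey f k))

module _ (x y : ℕ) where
  private
    π : ℕ → ℕ
    π = transpose x y

  permuteKey-involutive : ∀ k → permuteKey π (permuteKey π k) ≡ k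
  permuteKey-involutive cur    = refl
  permuteKey-involutive (hn n) = cong hn (transpose-involutive x y n)

  get-permuteVF : ∀ G k → get (permuteVF π G) (permuteKey π k) ≡ map π (get G k)
  get-permuteVF G k rewrite permuteKey-involutive k = fromMaybe-map (map π) (G k) refl

  permuteVF-upd : ∀ G k V → permuteVF π (upd G k V) ≐ upd (permuteVF π G) (permuteKey π k) (map π V)
  permuteVF-upd G k V k' with permuteKey π k' ≟K k
  ... | yes refl rewrite permuteKey-involutive k' =
    sym (upd-self (permuteVF π G) k' (map π V))
  ... | no πk'≢k =
    sym (upd-other (permuteVF π G) (permuteKey π k) (map π V) k'
                   (λ k'≡πk → πk'≢k (trans (cong (permuteKey π) k'≡πk) (permuteKey-involutive k))))

  permuteVF-∖cur : ∀ G → permuteVF π (G ∖ cur) ≐ permuteVF π G ∖ cur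
  permuteVF-∖cur G cur = trans (cong (M.map (map π)) (∖-self G cur)) (sym (∖-self (permuteVF π G) cur))
  permuteVF-∖cur G (hn n) =
    trans (cong (M.map (map π)) (∖cur-hn G (π n))) (sym (∖cur-hn (permuteVF π G) n))

  afterOut-permuteVF : ∀ {G G'} c b → G' ≐ permuteVF π G →
                       afterOut G' (π c) (π b) ≐ permuteVF π (afterOut G c b)
  afterOut-permuteVF {G} c b e =
    ≐-trans (upd-cong cur e
              (trans (cong (_∷ʳ π b) (trans (get-≐ (hn (π c)) e) (get-permuteVF G (hn c))))
                     (sym (map-++ π (get G (hn c)) [ b ]))))
            (≐-sym (permuteVF-upd G cur _))

  afterIn-permuteVF : ∀ {G G'} b → G' ≐ permuteVF π G →
                      afterIn G' (π b) ≐ permuteVF π (afterIn G b)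
  afterIn-permuteVF {G} b e =
    ≐-trans (upd-cong (hn (π b)) (≐-trans (∖-cong cur e) (≐-sym (permuteVF-∖cur G)))
              (trans (cong (_∷ʳ π b) (trans (get-≐ cur e) (get-permuteVF G cur)))
                     (sym (map-++ π (get G cur) [ b ]))))
            (≐-sym (permuteVF-upd (G ∖ cur) (hn b) _))

∈dom-≐ : ∀ {G G' k} → G ≐ G' → k ∈dom G → k ∈dom G'
∈dom-≐ {k = k} e (V , Gk≡V) = V , trans (sym (e k)) Gk≡V

map-just⁻ : ∀ {m : Maybe (List Name)} {m'} (f : List Name → List Name) → m' ≡ M.map f m →
            (∃ λ V → m' ≡ just V) → ∃ λ V → m ≡ just V
map-just⁻ {just V} f _ _ = V , refl
map-just⁻ {nothing} f refl (_ , ())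

map-just⁺ : ∀ {m : Maybe (List Name)} {m'} (f : List Name → List Name) → m' ≡ M.map f m →
            (∃ λ V → m ≡ just V) → ∃ λ V → m' ≡ just V
map-just⁺ f e (V , refl) = f V , e

∈dom-∖⁻ : ∀ G k {k'} → k' ≢ k → k' ∈dom (G ∖ k) → k' ∈dom G
∈dom-∖⁻ G k {k'} k'≢k = map-just⁻ (without k) (∖-val G k k' k'≢k)

∈dom-∖⁺ : ∀ G k {k'} → k' ≢ k → k' ∈dom G → k' ∈dom (G ∖ k)
∈dom-∖⁺ G k {k'} k'≢k = map-just⁺ (without k) (∖-val G k k' k'≢k)

∈at-≐ : ∀ {G G' k n} → G ≐ G' → n ∈at (G , k) → n ∈at (G' , k)
∈at-≐ {k = k} e (V , Gk≡V , n∈V) = V , trans (sym (e k)) Gk≡V , n∈V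

∈at-∖⁻ : ∀ G a k {n} → n ∈at (G ∖ hn a , k) → (k ≢ hn a) × (n ≢ a) × n ∈at (G , k)
∈at-∖⁻ G a k {n} (V , Gk≡V , n∈V) = k≢a , proj₂ n∈W×n≢a , W , Gk≡W , proj₁ n∈W×n≢a
  where
  k≢a : k ≢ hn a
  k≢a refl with () ← trans (sym Gk≡V) (∖-self G (hn a))
  W∈dom : k ∈dom G
  W∈dom = ∈dom-∖⁻ G (hn a) k≢a (V , Gk≡V)
  W : List Name
  W = proj₁ W∈dom
  Gk≡W : G k ≡ just W
  Gk≡W = proj₂ W∈dom
  V≡ : V ≡ without (hn a) W
  V≡ = M.just-injective
         (trans (sym Gk≡V) (trans (∖-val G (hn a) k k≢a) (cong (M.map (without (hn a))) Gk≡W)))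
  n∈W×n≢a : n ∈ W × n ≢ a
  n∈W×n≢a = ∈-without⁻ a W (subst (n ∈_) V≡ n∈V)

∈at-∖⁺ : ∀ G a k {n} → k ≢ hn a → n ≢ a → n ∈at (G , k) → n ∈at (G ∖ hn a , k)
∈at-∖⁺ G a k k≢a n≢a (V , Gk≡V , n∈V) =
  without (hn a) V , trans (∖-val G (hn a) k k≢a) (cong (M.map (without (hn a))) Gk≡V) ,
  ∈-without⁺ a V n∈V n≢a

channel≢ : ∀ {a c b : ℕ} → a ∉ c ∷ b ∷ [] → c ≢ a
channel≢ a∉ c≡a = a∉ (here (sym c≡a))

binder≢ : ∀ {a c b : ℕ} → a ∉ c ∷ b ∷ [] → b ≢ a
binder≢ a∉ b≡a = a∉ (there (here (sym b≡a)))

module _ {a : Name} {Gν G : VF} (Gν≐ : Gν ≐ G ∖ hn a) where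

  cur∈dom-∖⁻ : cur ∈dom Gν → cur ∈dom G
  cur∈dom-∖⁻ = ∈dom-∖⁻ G (hn a) cur≢hn ∘ ∈dom-≐ Gν≐

  cur∈dom-∖⁺ : cur ∈dom G → cur ∈dom Gν
  cur∈dom-∖⁺ = ∈dom-≐ (≐-sym Gν≐) ∘ ∈dom-∖⁺ G (hn a) cur≢hn

  hn∈dom-∖cur⁻ : ∀ {b} → b ≢ a → hn b ∈dom (Gν ∖ cur) → hn b ∈dom (G ∖ cur)
  hn∈dom-∖cur⁻ b≢a =
    ∈dom-∖⁺ G cur hn≢cur ∘ ∈dom-∖⁻ G (hn a) (hn≢ b≢a) ∘ ∈dom-≐ Gν≐ ∘ ∈dom-∖⁻ Gν cur hn≢cur

  hn∈dom-∖cur⁺ : ∀ {b} → b ≢ a → hn b ∈dom (G ∖ cur) → hn b ∈dom (Gν ∖ cur)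
  hn∈dom-∖cur⁺ b≢a =
    ∈dom-∖⁺ Gν cur hn≢cur ∘ ∈dom-≐ (≐-sym Gν≐) ∘ ∈dom-∖⁺ G (hn a) (hn≢ b≢a) ∘ ∈dom-∖⁻ G cur hn≢cur

module TraceSimulation (Related : VF → Proc → VF → Proc → Set) (f : Act → Act) (Admissible : Act → Set)
  (simulate-τ : ∀ {G S G' S' S₁} → Related G S G' S' → Allowed G S τ G S₁ →
                ∃ λ S₁' → Allowed G' S' τ G' S₁' × Related G S₁ G' S₁')
  (simulate : ∀ {G S G' S' μ G₁ S₁} → Related G S G' S' → Admissible μ → Allowed G S μ G₁ S₁ →
              ∃₂ λ G₁' S₁' → Allowed G' S' (f μ) G₁' S₁' × Related G₁ S₁ G₁' S₁') where

  simulate-τ* : ∀ {G S S₁ G' S'} → TauStar G S S₁ → Related G S G' S' →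
                ∃ λ S₁' → TauStar G' S' S₁' × Related G S₁ G' S₁'
  simulate-τ* τ-refl r = _ , τ-refl , r
  simulate-τ* (τ-step step steps) r with simulate-τ r step
  ... | _ , step' , r' with simulate-τ* steps r'
  ...   | S₁' , steps' , r'' = S₁' , τ-step step' steps' , r''

  simulate-trace : ∀ t {G S G' S'} → Related G S G' S' → All Admissible t →
                   TraceOf G S t → TraceOf G' S' (map f t)
  simulate-trace [] r _ _ = tt
  simulate-trace (μ ∷ t) r (adm ∷ adms) (G₁ , _ , (_ , _ , before , step , after) , rest)
    with simulate-τ* before r
  ... | S₁' , before' , r₁ with simulate r₁ adm step
  ...   | G₁' , S₂' , step' , r₂ with simulate-τ* after r₂
  ...     | S₃' , after' , r₃ =
    G₁' , S₃' , (S₁' , S₂' , before' , step' , after') , simulate-trace t r₃ adms rest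

module IntoRestriction (a : Name) where

  Restricted : VF → Proc → VF → Proc → Set
  Restricted G S G' S' = (G' ≐ G ∖ hn a) × (S' ≡α νH a S)

  simulate-τ : ∀ {G S G' S' S₁} → Restricted G S G' S' → Allowed G S τ G S₁ →
               ∃ λ S₁' → Allowed G' S' τ G' S₁' × Restricted G S₁ G' S₁'
  simulate-τ {S₁ = S₁} (e , S'≡α) (al-τ s cur∉) =
    νH a S₁ , al-τ (t-α S'≡α (t-νH s (λ ()))) (cur∉ ∘ cur∈dom-∖⁻ e) , e , α-refl

  simulate : ∀ {G S G' S' μ G₁ S₁} → Restricted G S G' S' → a ∉ actH μ → Allowed G S μ G₁ S₁ →
             ∃₂ λ G₁' S₁' → Allowed G' S' μ G₁' S₁' × Restricted G₁ S₁ G₁' S₁'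
  simulate {G} {S₁ = S₁} (e , S'≡α) a∉ (al-outHO {a = c} {b = b} s c∈dom cur∉) =
    _ , νH a S₁ ,
    al-outHO (t-α S'≡α (t-νH s a∉)) (∈dom-≐ (≐-sym e) (∈dom-∖⁺ G (hn a) (hn≢ (channel≢ a∉)) c∈dom))
             (cur∉ ∘ cur∈dom-∖⁻ e) ,
    afterOut-∖ a c b e (channel≢ a∉) (binder≢ a∉) , α-refl
  simulate {G} {S₁ = S₁} (e , S'≡α) a∉ (al-inHO {a = c} {b = b} s c∈cur b∉dom) =
    _ , νH a S₁ ,
    al-inHO (t-α S'≡α (t-νH s a∉)) (∈at-≐ (≐-sym e) (∈at-∖⁺ G a cur cur≢hn (channel≢ a∉) c∈cur))
            (b∉dom ∘ hn∈dom-∖cur⁻ e (binder≢ a∉)) ,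
    afterIn-∖ a b e (binder≢ a∉) , α-refl
  simulate {S₁ = S₁} (e , S'≡α) a∉ (al-outFO s cur∈) =
    _ , νH a S₁ , al-outFO (t-α S'≡α (t-νH s a∉)) (cur∈dom-∖⁺ e cur∈) , e , α-refl
  simulate {S₁ = S₁} (e , S'≡α) a∉ (al-inFO s cur∉) =
    _ , νH a S₁ , al-inFO (t-α S'≡α (t-νH s a∉)) (cur∉ ∘ cur∈dom-∖⁻ e) , e , α-refl
  simulate {S₁ = S₁} (e , S'≡α) a∉ (al-τ s cur∉) =
    _ , νH a S₁ , al-τ (t-α S'≡α (t-νH s a∉)) (cur∉ ∘ cur∈dom-∖⁻ e) , e , α-refl

  open TraceSimulation Restricted id (λ μ → a ∉ actH μ) simulate-τ simulate public

module OutOfRestriction (a : Name) where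

  Unrestricted : VF → Proc → VF → Proc → Set
  Unrestricted G S G' S' = (G ≐ G' ∖ hn a) × (S ≡α νH a S')

  simulate-τ : ∀ {G S G' S' S₁} → Unrestricted G S G' S' → Allowed G S τ G S₁ →
               ∃ λ S₁' → Allowed G' S' τ G' S₁' × Unrestricted G S₁ G' S₁'
  simulate-τ (e , S≡α) (al-τ s cur∉) with νH-step-inversion s S≡α (λ ())
  ... | S₁' , s' , S₁≡α = S₁' , al-τ s' (cur∉ ∘ cur∈dom-∖⁺ e) , e , S₁≡α

  simulate : ∀ {G S G' S' μ G₁ S₁} → Unrestricted G S G' S' → a ∉ actH μ → Allowed G S μ G₁ S₁ →
             ∃₂ λ G₁' S₁' → Allowed G' S' μ G₁' S₁' × Unrestricted G₁ S₁ G₁' S₁'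
  simulate {G' = G'} (e , S≡α) a∉ (al-outHO {a = c} {b = b} s c∈dom cur∉)
    with νH-step-inversion s S≡α a∉
  ... | S₁' , s' , S₁≡α =
    _ , S₁' , al-outHO s' (∈dom-∖⁻ G' (hn a) (hn≢ (channel≢ a∉)) (∈dom-≐ e c∈dom)) (cur∉ ∘ cur∈dom-∖⁺ e) ,
    afterOut-∖ a c b e (channel≢ a∉) (binder≢ a∉) , S₁≡α
  simulate {G' = G'} (e , S≡α) a∉ (al-inHO {a = c} {b = b} s c∈cur b∉dom)
    with νH-step-inversion s S≡α a∉
  ... | S₁' , s' , S₁≡α =
    _ , S₁' , al-inHO s' (proj₂ (proj₂ (∈at-∖⁻ G' a cur (∈at-≐ e c∈cur))))
                         (b∉dom ∘ hn∈dom-∖cur⁺ e (binder≢ a∉)) ,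
    afterIn-∖ a b e (binder≢ a∉) , S₁≡α
  simulate (e , S≡α) a∉ (al-outFO s cur∈) with νH-step-inversion s S≡α a∉
  ... | S₁' , s' , S₁≡α = _ , S₁' , al-outFO s' (cur∈dom-∖⁻ e cur∈) , e , S₁≡α
  simulate (e , S≡α) a∉ (al-inFO s cur∉) with νH-step-inversion s S≡α a∉
  ... | S₁' , s' , S₁≡α = _ , S₁' , al-inFO s' (cur∉ ∘ cur∈dom-∖⁺ e) , e , S₁≡α
  simulate (e , S≡α) a∉ (al-τ s cur∉) with νH-step-inversion s S≡α a∉
  ... | S₁' , s' , S₁≡α = _ , S₁' , al-τ s' (cur∉ ∘ cur∈dom-∖⁺ e) , e , S₁≡α

  open TraceSimulation Unrestricted id (λ μ → a ∉ actH μ) simulate-τ simulate public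

module Equivariance (x y : ℕ) where
  private
    π : ℕ → ℕ
    π = transpose x y
    π-injective : Injective _≡_ _≡_ π
    π-injective = transpose-injective x y

  Permuted : VF → Proc → VF → Proc → Set
  Permuted G S G' S' = (G' ≐ permuteVF π G) × (S' ≡α rename π S)

  ∈dom-permute⁻ : ∀ G {G'} → G' ≐ permuteVF π G → ∀ k → permuteKey π k ∈dom G' → k ∈dom G
  ∈dom-permute⁻ G e k =
    map-just⁻ (map π) (trans (e (permuteKey π k)) (cong (M.map (map π) ∘ G) (permuteKey-involutive x y k)))

  ∈dom-permute⁺ : ∀ G {G'} → G' ≐ permuteVF π G → ∀ k → k ∈dom G → permuteKey π k ∈dom G'
  ∈dom-permute⁺ G e k =
    map-just⁺ (map π) (trans (e (permuteKey π k)) (cong (M.map (map π) ∘ G) (permuteKey-involutive x y k)))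

  simulate-τ : ∀ {G S G' S' S₁} → Permuted G S G' S' → Allowed G S τ G S₁ →
               ∃ λ S₁' → Allowed G' S' τ G' S₁' × Permuted G S₁ G' S₁'
  simulate-τ {G} {S₁ = S₁} (e , S'≡α) (al-τ s cur∉) =
    rename π S₁ , al-τ (t-α S'≡α (rename-step π-injective s)) (cur∉ ∘ ∈dom-permute⁻ G e cur) , e , α-refl

  simulate : ∀ {G S G' S' μ G₁ S₁} → Permuted G S G' S' → ⊤ → Allowed G S μ G₁ S₁ →
             ∃₂ λ G₁' S₁' → Allowed G' S' (renameAct π μ) G₁' S₁' × Permuted G₁ S₁ G₁' S₁'
  simulate {G} {G' = G'} {S₁ = S₁} (e , S'≡α) _ (al-outHO {a = c} {b = b} s c∈dom cur∉) =
    _ , rename π S₁ ,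
    al-outHO (t-α S'≡α (rename-step π-injective s)) (∈dom-permute⁺ G e (hn c) c∈dom)
             (cur∉ ∘ ∈dom-permute⁻ G e cur) ,
    afterOut-permuteVF x y {G} c b e , α-refl
  simulate {G} {G' = G'} {S₁ = S₁} (e , S'≡α) _ (al-inHO {a = c} {b = b} s (V , Gcur≡V , c∈V) b∉dom) =
    _ , rename π S₁ ,
    al-inHO (t-α S'≡α (rename-step π-injective s))
            (map π V , trans (e cur) (cong (M.map (map π)) Gcur≡V) , ∈-map⁺ π c∈V)
            (b∉dom ∘ ∈dom-∖⁺ G cur hn≢cur ∘ ∈dom-permute⁻ G e (hn b) ∘ ∈dom-∖⁻ G' cur hn≢cur) ,
    afterIn-permuteVF x y {G} b e , α-refl
  simulate {G} {S₁ = S₁} (e , S'≡α) _ (al-outFO s cur∈) =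
    _ , rename π S₁ ,
    al-outFO (t-α S'≡α (rename-step π-injective s)) (∈dom-permute⁺ G e cur cur∈) , e , α-refl
  simulate {G} {S₁ = S₁} (e , S'≡α) _ (al-inFO s cur∉) =
    _ , rename π S₁ ,
    al-inFO (t-α S'≡α (rename-step π-injective s)) (cur∉ ∘ ∈dom-permute⁻ G e cur) , e , α-refl
  simulate {G} {S₁ = S₁} (e , S'≡α) _ (al-τ s cur∉) =
    _ , rename π S₁ ,
    al-τ (t-α S'≡α (rename-step π-injective s)) (cur∉ ∘ ∈dom-permute⁻ G e cur) , e , α-refl

  open TraceSimulation Permuted (renameAct π) (λ _ → ⊤) simulate-τ simulate public

renameAct-transpose-involutive : ∀ x y μ → renameAct (transpose x y) (renameAct (transpose x y) μ) ≡ μ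
renameAct-transpose-involutive x y τ = refl
renameAct-transpose-involutive x y (inA a v b) =
  cong₂ (λ u w → inA u v w) (transpose-involutive x y a) (transpose-involutive x y b)
renameAct-transpose-involutive x y (outA a v b) =
  cong₂ (λ u w → outA u v w) (transpose-involutive x y a) (transpose-involutive x y b)
renameAct-transpose-involutive x y (inF h v) = refl
renameAct-transpose-involutive x y (outF h v) = refl
renameAct-transpose-involutive x y (ok w) = refl

map-renameAct-transpose-involutive : ∀ x y t →
  map (renameAct (transpose x y)) (map (renameAct (transpose x y)) t) ≡ t
map-renameAct-transpose-involutive x y [] = refl
map-renameAct-transpose-involutive x y (μ ∷ t) =
  cong₂ _∷_ (renameAct-transpose-involutive x y μ) (map-renameAct-transpose-involutive x y t)

bns-renameAct : ∀ f t → bns (map (renameAct f) t) ≡ map f (bns t)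
bns-renameAct f [] = refl
bns-renameAct f (τ ∷ t) = bns-renameAct f t
bns-renameAct f (inA a v b ∷ t) = cong (f b ∷_) (bns-renameAct f t)
bns-renameAct f (outA a v b ∷ t) = cong (f b ∷_) (bns-renameAct f t)
bns-renameAct f (inF h v ∷ t) = bns-renameAct f t
bns-renameAct f (outF h v ∷ t) = bns-renameAct f t
bns-renameAct f (ok w ∷ t) = bns-renameAct f t

chans-renameAct : ∀ f t → chans (map (renameAct f) t) ≡ map f (chans t)
chans-renameAct f [] = refl
chans-renameAct f (τ ∷ t) = chans-renameAct f t
chans-renameAct f (inA a v b ∷ t) = cong (f a ∷_) (chans-renameAct f t)
chans-renameAct f (outA a v b ∷ t) = cong (f a ∷_) (chans-renameAct f t)
chans-renameAct f (inF h v ∷ t) = chans-renameAct f t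
chans-renameAct f (outF h v ∷ t) = chans-renameAct f t
chans-renameAct f (ok w ∷ t) = chans-renameAct f t

bn-renameAct : ∀ f μ {b} → bn μ ≡ just b → bn (renameAct f μ) ≡ just (f b)
bn-renameAct f (inA a v b) refl = refl
bn-renameAct f (outA a v b) refl = refl

renameAct-≢τ : ∀ f μ → μ ≢ τ → renameAct f μ ≢ τ
renameAct-≢τ f τ ne _ = ne refl
renameAct-≢τ f (inA _ _ _) ne ()
renameAct-≢τ f (outA _ _ _) ne ()
renameAct-≢τ f (inF _ _) ne ()
renameAct-≢τ f (outF _ _) ne ()
renameAct-≢τ f (ok _) ne ()

IsTrace-transpose : ∀ x y t → IsTrace t → IsTrace (map (renameAct (transpose x y)) t)
IsTrace-transpose x y t (non-τ , unique , bound-fresh) =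
  map⁺ (All.map (renameAct-≢τ π _) non-τ) ,
  subst Unique (sym (bns-renameAct π t)) (Unique.map⁺ (transpose-injective x y) unique) ,
  bound-fresh′
  where
  π : ℕ → ℕ
  π = transpose x y
  bound-fresh′ : ∀ xs μ ys b → map (renameAct π) t ≡ xs ++ μ ∷ ys → bn μ ≡ just b → b ∉ chans (xs ∷ʳ μ)
  bound-fresh′ xs μ ys b t≡ bn≡ b∈ =
    bound-fresh (map (renameAct π) xs) (renameAct π μ) (map (renameAct π) ys) (π b) split
                (bn-renameAct π μ bn≡) πb∈
    where
    split : t ≡ map (renameAct π) xs ++ renameAct π μ ∷ map (renameAct π) ys
    split = trans (sym (map-renameAct-transpose-involutive x y t))
                  (trans (cong (map (renameAct π)) t≡) (map-++ (renameAct π) xs (μ ∷ ys)))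
    πb∈ : π b ∈ chans (map (renameAct π) xs ∷ʳ renameAct π μ)
    πb∈ = subst (π b ∈_)
                (trans (sym (chans-renameAct π (xs ∷ʳ μ))) (cong chans (map-++ (renameAct π) xs [ μ ])))
                (∈-map⁺ π b∈)

traceNames : List Act → List ℕ
traceNames []      = []
traceNames (μ ∷ t) = actH μ ++ traceNames t

transpose-avoids : ∀ a z t → z ∉ traceNames t → All (λ μ → a ∉ actH μ) (map (renameAct (transpose a z)) t)
transpose-avoids a z [] _ = []
transpose-avoids a z (μ ∷ t) z∉ = a∉πμ ∷ transpose-avoids a z t (∉++⇒∉ʳ (actH μ) z∉)
  where
  a∉πμ : a ∉ actH (renameAct (transpose a z) μ)
  a∉πμ a∈ with ∈-map⁻ (transpose a z) (subst (a ∈_) (actH-renameAct (transpose a z) μ) a∈)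
  ... | m , m∈ , a≡πm = z∉ (∈-++⁺ˡ (subst (_∈ actH μ) m≡z m∈))
    where
    m≡z : m ≡ z
    m≡z = trans (sym (transpose-involutive a z m)) (trans (cong (transpose a z) (sym a≡πm)) (transpose-ˡ a z))

infix 4 _#_
_#_ : ℕ → VF → Set
z # G = G (hn z) ≡ nothing × (∀ k {V} → G k ≡ just V → z ∉ V)

keyNames : Key → List ℕ
keyNames cur    = []
keyNames (hn n) = n ∷ []

observerNames : VF → List Key → List ℕ
observerNames G []      = []
observerNames G (k ∷ L) = keyNames k ++ get G k ++ observerNames G L

∈-observerNames : ∀ G {k L n} → k ∈ L → n ∈ keyNames k ++ get G k → n ∈ observerNames G L
∈-observerNames G {k} (here refl) n∈ = subst (_ ∈_) (++-assoc (keyNames k) (get G k) _) (∈-++⁺ˡ n∈)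
∈-observerNames G {L = k' ∷ L} (there k∈) n∈ =
  ∈-++⁺ʳ (keyNames k') (∈-++⁺ʳ (get G k') (∈-observerNames G k∈ n∈))

∉observerNames⇒# : ∀ G L → (∀ k → k ∈dom G → k ∈ L) → ∀ {z} → z ∉ observerNames G L → z # G
∉observerNames⇒# G L covers {z} z∉ = not-key , not-value
  where
  not-key : G (hn z) ≡ nothing
  not-key with G (hn z) in Gz
  ... | nothing = refl
  ... | just V  = ⊥-elim (z∉ (∈-observerNames G (covers (hn z) (V , Gz)) (here refl)))
  not-value : ∀ k {V} → G k ≡ just V → z ∉ V
  not-value k {V} Gk≡V z∈V = z∉ (∈-observerNames G (covers k (V , Gk≡V))
    (∈-++⁺ʳ (keyNames k) (subst (λ m → z ∈ M.fromMaybe [] m) (sym Gk≡V) z∈V)))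

∖-permuteVF-fixed : ∀ G a z → z ≢ a → z # G → G ∖ hn a ≐ permuteVF (transpose a z) (G ∖ hn a)
∖-permuteVF-fixed G a z z≢a (Gz≡nothing , z∉values) k =
  sym (trans (values-fixed (permuteKey π k)) (key-fixed k))
  where
  π : ℕ → ℕ
  π = transpose a z
  values-fixed : ∀ k → M.map (map π) ((G ∖ hn a) k) ≡ (G ∖ hn a) k
  values-fixed k with k ≟K hn a
  ... | yes refl = refl
  ... | no _ with G k in Gk
  ...   | nothing = refl
  ...   | just V  = cong just (map-id-local (All.tabulate π-fixes))
    where
    π-fixes : ∀ {n} → n ∈ without (hn a) V → π n ≡ n
    π-fixes {n} n∈ with ∈-without⁻ a V n∈
    ... | n∈V , n≢a = transpose-other a z n n≢a (λ n≡z → z∉values k Gk (subst (_∈ V) n≡z n∈V))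
  key-fixed : ∀ k → (G ∖ hn a) (permuteKey π k) ≡ (G ∖ hn a) k
  key-fixed cur = refl
  key-fixed (hn n) with transpose-view a z n
  ... | at-x refl rewrite transpose-ˡ n z =
    trans (∖-val G (hn n) (hn z) (hn≢ z≢a))
          (trans (cong (M.map (without (hn n))) Gz≡nothing) (sym (∖-self G (hn n))))
  ... | at-y _ refl rewrite transpose-ʳ a n =
    trans (∖-self G (hn a))
          (sym (trans (∖-val G (hn a) (hn n) (hn≢ z≢a)) (cong (M.map (without (hn a))) Gz≡nothing)))
  ... | elsewhere n≢a n≢z rewrite transpose-other a z n n≢a n≢z = refl

∈dom-∖ : ∀ G k₀ k → k ∈dom (G ∖ k₀) → k ∈dom G
∈dom-∖ G k₀ k k∈ with k ≟K k₀
... | yes refl with () ← proj₂ k∈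
... | no _ = map-just⁻ (without k₀) refl k∈

IsVis-∖ : ∀ Δ a → IsVis Δ → IsVis (Δ ∖ hn a)
IsVis-∖ Δ a ((L , covers) , transitive) = (L , λ k → covers k ∘ ∈dom-∖ Δ (hn a) k) , transitive′
  where
  transitive′ : ∀ o b → b ∈at (Δ ∖ hn a , o) → hn b ∈dom (Δ ∖ hn a) →
                ∀ n → n ∈at (Δ ∖ hn a , hn b) → n ∈at (Δ ∖ hn a , o)
  transitive′ o b b∈o b∈dom n n∈b with ∈at-∖⁻ Δ a o b∈o | ∈at-∖⁻ Δ a (hn b) n∈b
  ... | o≢a , _ , b∈Δo | _ , n≢a , n∈Δb =
    ∈at-∖⁺ Δ a o o≢a n≢a (transitive o b b∈Δo (∈dom-∖ Δ (hn a) (hn b) b∈dom) n n∈Δb)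

≈V-refl : ∀ G → G ≈V G
≈V-refl G k = (id , id) , λ n → id , id

Typed-νH : ∀ Δ a P → IsVis Δ → Typed Δ P → Typed (Δ ∖ hn a) (νH a P)
Typed-νH Δ a P Δ-vis (P₀ , P≡αP₀ , ⊢P₀) =
  νH a P₀ , c-νH P≡αP₀ , ty-νH (IsVis-∖ Δ a Δ-vis) (≈V-refl _) ⊢P₀

νH≡α-transpose : ∀ a z P → z ∉ hnames P → νH a P ≡α rename (transpose a z) (νH a P)
νH≡α-transpose a z P z∉ rewrite transpose-ˡ a z =
  α-trans (α-νH z∉) (c-νH (subst (hren z a P ≡α_) (rename-ext (transpose-comm z a) P)
                                 (hren≡α-rename-transpose z a P z∉)))

module _ {Γ : VF} {a : Name} where

  trace-transpose-fresh : ∀ {z P} t → z ≢ a → z # Γ → z ∉ hnames P →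
                          TraceOf (Γ ∖ hn a) (νH a P) t →
                          TraceOf (Γ ∖ hn a) (νH a P) (map (renameAct (transpose a z)) t)
  trace-transpose-fresh {z} {P} t z≢a z#Γ z∉P =
    Equivariance.simulate-trace a z t (∖-permuteVF-fixed Γ a z z≢a z#Γ , νH≡α-transpose a z P z∉P)
                                (All.universal (λ _ → tt) t)

  trace-νH⁻ : ∀ {P} t → All (λ μ → a ∉ actH μ) t → TraceOf (Γ ∖ hn a) (νH a P) t → TraceOf Γ P t
  trace-νH⁻ {P} t avoids = subst (TraceOf Γ P) (map-id t) ∘
    OutOfRestriction.simulate-trace a t (≐-refl , α-refl) avoids

  trace-νH⁺ : ∀ {P} t → All (λ μ → a ∉ actH μ) t → TraceOf Γ P t → TraceOf (Γ ∖ hn a) (νH a P) t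
  trace-νH⁺ {P} t avoids = subst (TraceOf (Γ ∖ hn a) (νH a P)) (map-id t) ∘
    IntoRestriction.simulate-trace a t (≐-refl , α-refl) avoids

νH-trace-inclusion : ∀ Γ a P Q → IsVis Γ →
                     (∀ t → IsTrace t → TraceOf Γ P t → TraceOf Γ Q t) →
                     ∀ t → IsTrace t → TraceOf (Γ ∖ hn a) (νH a P) t → TraceOf (Γ ∖ hn a) (νH a Q) t
νH-trace-inclusion Γ a P Q ((L , covers) , _) P⊑Q t t-trace νP-does-t
  with fresh (a ∷ hnames P ++ hnames Q ++ traceNames t ++ observerNames Γ L)
... | z , z∉ =
  subst (TraceOf (Γ ∖ hn a) (νH a Q)) (map-renameAct-transpose-involutive a z t)
    (trace-transpose-fresh t′ z≢a z#Γ z∉Q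
      (trace-νH⁺ t′ t′-avoids-a
        (P⊑Q t′ (IsTrace-transpose a z t t-trace)
          (trace-νH⁻ t′ t′-avoids-a
            (trace-transpose-fresh t z≢a z#Γ z∉P νP-does-t)))))
  where
  t′ : List Act
  t′ = map (renameAct (transpose a z)) t
  z≢a : z ≢ a
  z≢a = z∉ ∘ here
  z∉P : z ∉ hnames P
  z∉P = ∉++⇒∉ˡ (hnames P) (∉∷⇒∉ z∉)
  z∉rest : z ∉ hnames Q ++ traceNames t ++ observerNames Γ L
  z∉rest = ∉++⇒∉ʳ (hnames P) (∉∷⇒∉ z∉)
  z∉Q : z ∉ hnames Q
  z∉Q = ∉++⇒∉ˡ (hnames Q) z∉rest
  t′-avoids-a : All (λ μ → a ∉ actH μ) t′
  t′-avoids-a = transpose-avoids a z t (∉++⇒∉ˡ (traceNames t) (∉++⇒∉ʳ (hnames Q) z∉rest))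
  z#Γ : z # Γ
  z#Γ = ∉observerNames⇒# Γ L covers (∉++⇒∉ʳ (traceNames t) (∉++⇒∉ʳ (hnames Q) z∉rest))

mainTheorem4 : (Δ Γ : VF) (a : Name) (P Q : Proc) →
               IsVis Δ → IsVis Γ → Closed P → Closed Q →
               TraceEq Δ Γ P Q →
               TraceEq (Δ ∖ hn a) (Γ ∖ hn a) (νH a P) (νH a Q)
mainTheorem4 Δ Γ a P Q Δ-vis Γ-vis _ _ (⊢P , ⊢Q , compatible , same-traces) =
  Typed-νH Δ a P Δ-vis ⊢P ,
  Typed-νH Δ a Q Δ-vis ⊢Q ,
  (λ (cur∈Δν , cur∈Γν) → compatible (∈dom-∖⁻ Δ (hn a) cur≢hn cur∈Δν , ∈dom-∖⁻ Γ (hn a) cur≢hn cur∈Γν)) ,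
  λ t t-trace → νH-trace-inclusion Γ a P Q Γ-vis (λ t → proj₁ ∘ same-traces t) t t-trace ,
                νH-trace-inclusion Γ a Q P Γ-vis (λ t → proj₂ ∘ same-traces t) t t-trace
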